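{- There is a unique map $Q(P)=Q(P;a,b,c,x,y,\alpha,\beta,\gamma)$ from packaged arrow presentations $P=(A,\mathcal V,\mathcal B)$ to $\mathbb{Z}[a,b,c,x,y,\alpha,\beta,\gamma]$ such that \[Q(P)=aQ(P\setminus e)+bQ(P/e)+cQ(P\dagger e)+xQ(P\setminus_m e)+yQ(P/_m e)\] for any edge $e$ of $P$, and $Q(P)=\alpha^{|V(A)|}\beta^{|\mathcal V|}\gamma^{|\mathcal B|}$ if $A$ has no edges.
   Context: An arrow presentation $A$ consists of a finite set $V(A)$ of disjoint circles (the vertices), a finite set of pairwise disjoint arrows (directed arcs) on the circles, and a finite set $E(A)$ of labels (the edges) such that every arrow carries one label and every label is carried by exactly two arrows (constituting that edge). An arrow along a circle from $p$ to $q$ is written $\overrightarrow{pq}$. Arrow presentations are considered up to equivalence (diffeomorphism of circles sending arrows to arrows, reversing both arrows of some edges, relabelling edges bijectively). Boundary components: for every edge $e$ with arrows $\overrightarrow{p_1p_2},\overrightarrow{q_1q_2}$, remove the arrows with the interiors of their arcs and add a curve joining $q_2$ to $p_1$ and one joining $p_2$ to $q_1$; the resulting closed curves form $B(A)$. For an edge $e$ with arrows $\overrightarrow{p_1p_2},\overrightarrow{q_1q_2}$: $A\setminus e$ removes the two arrows (not their arcs) and $e$; $A/e$ removes the arrows with the interiors of their arcs, identifies $p_1$ with $q_2$ and $p_2$ with $q_1$, and removes $e$; $A\dagger e$ (Penrose-contraction) does the same but identifies $p_1$ with $q_1$ and $p_2$ with $q_2$. A packaged arrow presentation is $P=(A,\mathcal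 V,\mathcal B)$ with $\mathcal V$ a partition of $V(A)$, $\mathcal B$ a partition of $B(A)$; $[v]$ is the block containing $v$. For an edge $e$ with incident vertices $u,v$ and incident boundary components $a,b$ (possibly equal): vertices of $A$ and $A\setminus e$ are identified; vertices of $A$ other than $u,v$ are identified with vertices of $A/e$ (resp. $A\dagger e$) and the rest form the set $T$ of created vertices; boundary components of $A$ and $A/e$ are identified; boundary components of $A$ other than $a,b$ are identified with those of $A\setminus e$ (resp. $A\dagger e$) and the rest form the set $S$ of created boundary components. Put $\mathcal V'=(\mathcal V-\{[u],[v]\})\cup\{[u]\cup[v]\}$, $\mathcal B'=(\mathcal B-\{[a],[b]\})\cup\{[a]\cup[b]\cup S-\{a,b\}\}$ ($S$ from deletion), $\mathcal V''=(\mathcal V-\{[u],[v]\})\cup\{[u]\cup[v]\cup T-\{u,v\}\}$ ($T$ from contraction), $\mathcal B''=(\mathcal B-\{[a],[b]\})\cup\{[a]\cup[b]\}$, and $\mathcal V''',\mathcal B'''$ defined like $\mathcal V'',\mathcal B'$ with $T,S$ created by the Penrose-contraction. Then $P\setminus e=(A\setminus e,\mathcal V,\mathcal B')$, $P\setminus_m e=(A\setminus e,\mathcal V',\mathcal B')$ (merge-deletion), $P/e=(A/e,\mathcal V'',\mathcal B)$, $P/_m e=(A/e,\mathcal V'',\mathcal B'')$ (merge-contraction), $P\dagger e=(A\dagger e,\mathcal V''',\mathcal B''')$. -}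

module Defs where

open import Data.Nat using (ℕ; zero; suc; _≡ᵇ_)
open import Data.Nat.Properties using () renaming (_≟_ to _≟ℕ_)
open import Data.Fin using (Fin; zero; suc; punchIn; punchOut) renaming (_≟_ to _≟F_)
open import Data.Product using (Σ; _×_; _,_; proj₁; proj₂)
open import Data.Product.Properties using (≡-dec)
open import Data.Sum using (_⊎_; inj₁; inj₂)
open import Data.Bool using (Bool; true; false; if_then_else_; _∧_; not)
open import Data.List using (List; []; _∷_; _++_; map; length; deduplicate)
open import Relation.Binary.PropositionalEquality using (_≡_; _≢_)
open import Relation.Nullary using (does; yes; no; ¬_)
open import Relation.Binary.Definitions using (DecidableEquality)

-- The polynomial ring ℤ[a,b,c,x,y,α,β,γ], realised as the free
-- commutative ring on 8 generators: ring terms modulo the congruence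
-- generated by the commutative-ring axioms.

data Poly : Set where
  𝟘 𝟙 : Poly
  var : Fin 8 → Poly
  _⊕_ _⊗_ : Poly → Poly → Poly
  ⊖_ : Poly → Poly

infixl 6 _⊕_
infixl 7 _⊗_
infix 4 _≈_

data _≈_ : Poly → Poly → Set where
  ≈-refl  : ∀ {p} → p ≈ p
  ≈-sym   : ∀ {p q} → p ≈ q → q ≈ p
  ≈-trans : ∀ {p q r} → p ≈ q → q ≈ r → p ≈ r
  ⊕-cong  : ∀ {p p' q q'} → p ≈ p' → q ≈ q' → p ⊕ q ≈ p' ⊕ q'
  ⊗-cong  : ∀ {p p' q q'} → p ≈ p' → q ≈ q' → p ⊗ q ≈ p' ⊗ q'
  ⊖-cong  : ∀ {p p'} → p ≈ p' → ⊖ p ≈ ⊖ p'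
  ⊕-assoc : ∀ p q r → (p ⊕ q) ⊕ r ≈ p ⊕ (q ⊕ r)
  ⊕-comm  : ∀ p q → p ⊕ q ≈ q ⊕ p
  ⊕-idˡ   : ∀ p → 𝟘 ⊕ p ≈ p
  ⊖-invˡ  : ∀ p → (⊖ p) ⊕ p ≈ 𝟘
  ⊗-assoc : ∀ p q r → (p ⊗ q) ⊗ r ≈ p ⊗ (q ⊗ r)
  ⊗-comm  : ∀ p q → p ⊗ q ≈ q ⊗ p
  ⊗-idˡ   : ∀ p → 𝟙 ⊗ p ≈ p
  distribˡ : ∀ p q r → p ⊗ (q ⊕ r) ≈ (p ⊗ q) ⊕ (p ⊗ r)

_^_ : Poly → ℕ → Poly
p ^ zero  = 𝟙
p ^ suc n = p ⊗ (p ^ n)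

𝕒 𝕓 𝕔 𝕩 𝕪 𝛼 𝛽 𝛾 : Poly
𝕒 = var (# 0) where open Data.Fin using (#_)
𝕓 = var (# 1) where open Data.Fin using (#_)
𝕔 = var (# 2) where open Data.Fin using (#_)
𝕩 = var (# 3) where open Data.Fin using (#_)
𝕪 = var (# 4) where open Data.Fin using (#_)
𝛼 = var (# 5) where open Data.Fin using (#_)
𝛽 = var (# 6) where open Data.Fin using (#_)
𝛾 = var (# 7) where open Data.Fin using (#_)

-- Edge e has two arrows  p1→p2  and  q1→q2; its four
-- arrow endpoints are the points (e , j), with j = 0,1,2,3 standing for
-- p1, p2, q1, q2.  Removing the (open) arrows from the circles leaves
-- arcs ("gaps"), each joining two distinct endpoints; `gap` is the
-- resulting fixed-point-free involution on endpoints.  The circles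
-- carrying at least one arrow are the cycles alternating `gap` and the
-- arrows (tA).  Circles carrying no arrow are listed in `iso`.
--
-- A partition of a finite set is encoded by a labelling of its elements
-- by natural numbers (block = set of elements with the same label).
-- Vertex labels are attached to endpoints (constant along vertices),
-- boundary labels likewise (constant along boundary components, which
-- are the cycles alternating `gap` and tB, i.e. the curves q2–p1,
-- p2–q1).  Each arrowless circle is both a vertex and a boundary
-- component and carries a pair (vertex label , boundary label).

Pt : ℕ → Set
Pt m = Fin m × Fin 4

_≟Pt_ : ∀ {m} → DecidableEquality (Pt m)
_≟Pt_ = ≡-dec _≟F_ _≟F_

-- local involutions on the four endpoints of an edge
-- tA : along the arrows        p1↔p2 , q1↔q2  (deletion / vertices)
-- tB : contraction gluing      p1↔q2 , p2↔q1  (contraction / boundaries)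
-- tC : Penrose gluing          p1↔q1 , p2↔q2  (Penrose-contraction)
tA tB tC : Fin 4 → Fin 4
tA zero = suc zero
tA (suc zero) = zero
tA (suc (suc zero)) = suc (suc (suc zero))
tA (suc (suc (suc zero))) = suc (suc zero)
tB zero = suc (suc (suc zero))
tB (suc zero) = suc (suc zero)
tB (suc (suc zero)) = suc zero
tB (suc (suc (suc zero))) = zero
tC zero = suc (suc zero)
tC (suc zero) = suc (suc (suc zero))
tC (suc (suc zero)) = zero
tC (suc (suc (suc zero))) = suc zero

record PAP (m : ℕ) : Set where
  field
    gap  : Pt m → Pt m
    vlab : Pt m → ℕ
    blab : Pt m → ℕ
    iso  : List (ℕ × ℕ)
open PAP public

arrow bnd : ∀ {m} → Pt m → Pt m
arrow (i , j) = (i , tA j)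
bnd   (i , j) = (i , tB j)

record WF {m : ℕ} (P : PAP m) : Set where
  field
    gap-invol : ∀ x → gap P (gap P x) ≡ x
    gap-fpf   : ∀ x → gap P x ≢ x
    vlab-gap  : ∀ x → vlab P (gap P x) ≡ vlab P x
    vlab-arr  : ∀ x → vlab P (arrow x) ≡ vlab P x
    blab-gap  : ∀ x → blab P (gap P x) ≡ blab P x
    blab-bnd  : ∀ x → blab P (bnd x) ≡ blab P x

-- Generic edge operation.  τ says how the endpoints of e are glued
-- once e is removed (tA: deletion, tB: contraction, tC: Penrose);
-- mV / mB say whether the vertex / boundary blocks of e are merged
-- (the created vertices / boundary components always have label of
-- [u] resp. [a], which is what the merged block receives).

relabel : ℕ → ℕ → ℕ → ℕ
relabel from to l = if l ≡ᵇ from then to else l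

module _ {n : ℕ} (τ : Fin 4 → Fin 4) (mV mB : Bool)
         (P : PAP (suc n)) (e : Fin (suc n)) where

  liftPt : Pt n → Pt (suc n)
  liftPt (i , j) = (punchIn e i , j)

  exitPt : Pt (suc n) → Pt n ⊎ Fin 4
  exitPt (i , j) with e ≟F i
  ... | yes _ = inj₂ j
  ... | no e≢i = inj₁ (punchOut e≢i , j)

  -- walk along gaps, passing through the endpoints of e via τ
  follow : ℕ → Pt n → Pt (suc n) → Pt n
  follow fuel d y with exitPt y
  follow fuel    d y | inj₁ z = z
  follow zero    d y | inj₂ j = d
  follow (suc f) d y | inj₂ j = follow f d (gap P (e , τ j))

  newGap : Pt n → Pt n
  newGap x = follow 4 x (gap P (liftPt x))

  lu lv la lb : ℕ
  lu = vlab P (e , zero)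
  lv = vlab P (e , suc (suc zero))
  la = blab P (e , zero)
  lb = blab P (e , suc zero)

  fV fB : ℕ → ℕ
  fV l = if mV then relabel lv lu l else l
  fB l = if mB then relabel lb la l else l

  -- new circles without arrows: cycles (alternating gap and τ) that lie
  -- entirely among the endpoints of e.  The τ-pairs are {0 , τ 0} and
  -- {s , τ s}.
  s : Fin 4
  s = if does (τ zero ≟F suc zero) then suc (suc zero) else suc zero

  closed1 : Fin 4 → Bool      -- cycle through the single τ-pair of j
  closed1 j = does (gap P (e , τ j) ≟Pt (e , j))

  closed2 : Bool              -- one cycle through both τ-pairs
  closed2 with gap P (e , τ zero)
  ... | (i , j1) = does (i ≟F e) ∧ not (does (j1 ≟F zero)) ∧ not (does (j1 ≟F τ zero))
                   ∧ does (gap P (e , τ j1) ≟Pt (e , zero))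

  circ : Fin 4 → ℕ × ℕ
  circ j = (fV (vlab P (e , j)) , fB (blab P (e , j)))

  newIso : List (ℕ × ℕ)
  newIso = (if closed1 zero then circ zero ∷ [] else [])
        ++ (if closed1 s then circ s ∷ [] else [])
        ++ (if closed2 then circ zero ∷ [] else [])

  edgeOp : PAP n
  edgeOp = record
    { gap  = newGap
    ; vlab = λ x → fV (vlab P (liftPt x))
    ; blab = λ x → fB (blab P (liftPt x))
    ; iso  = map (λ { (v , b) → (fV v , fB b) }) (iso P) ++ newIso
    }

del delm con conm pen : ∀ {n} → PAP (suc n) → Fin (suc n) → PAP n
del  = edgeOp tA false true
delm = edgeOp tA true  true
con  = edgeOp tB true  false
conm = edgeOp tB true  true
pen  = edgeOp tC true  true

numBlocks : List ℕ → ℕ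
numBlocks ls = length (deduplicate _≟ℕ_ ls)

|V| |𝒱| |ℬ| : PAP 0 → ℕ
|V| P = length (iso P)
|𝒱| P = numBlocks (map proj₁ (iso P))
|ℬ| P = numBlocks (map proj₂ (iso P))

Recursion : (∀ {m} → PAP m → Poly) → Set
Recursion Q = ∀ {n} (P : PAP (suc n)) → WF P → (e : Fin (suc n)) →
  Q P ≈ 𝕒 ⊗ Q (del P e) ⊕ 𝕓 ⊗ Q (con P e) ⊕ 𝕔 ⊗ Q (pen P e)
        ⊕ 𝕩 ⊗ Q (delm P e) ⊕ 𝕪 ⊗ Q (conm P e)

Base : (∀ {m} → PAP m → Poly) → Set
Base Q = (P : PAP 0) → WF P → Q P ≈ (𝛼 ^ |V| P) ⊗ (𝛽 ^ |𝒱| P) ⊗ (𝛾 ^ |ℬ| P)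

-- Recursion along edge 0 forces Q, which gives uniqueness and a candidate.
-- The candidate satisfies the recursion along every edge because operations
-- on two distinct edges commute: removing edge 0 and then edge e + 1 (by any
-- two of the five operations) or the other way round gives presentations with
-- the same gap, whose labels and arrowless circles differ only by
-- relabellings, which Q does not see.  The gaps agree because both are
-- determined by the walk in P crossing both edges; the two composite
-- relabellings absorb each other; and the created circles correspond, which
-- is checked exhaustively over all the ways the gap can connect the eight
-- endpoints of the two edges.

module Submission where

open import Defs
open import Data.Bool using (Bool; true; false; T; _∧_; _∨_; _xor_; not; if_then_else_)
open import Data.Bool.ListAction using (all; any)
open import Data.Bool.Properties using (T-∧; T-∨; xor-same)
open import Data.Empty using (⊥; ⊥-elim)
open import Data.Fin using (Fin; zero; suc; punchIn; punchOut) renaming (_≟_ to _≟F_)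
open import Data.Fin.Properties
  using (all?; suc-injective; punchIn-injective; punchInᵢ≢i; punchIn-punchOut; punchOut-punchIn; punchOut-cong)
open import Data.List using (List; []; _∷_; _++_; map; length; deduplicate; allFin; cartesianProduct)
open import Data.List.Membership.Propositional using (_∈_; _─_; find)
open import Data.List.Membership.Propositional.Properties
  using (∈-map⁺; ∈-map⁻; ∈-++⁺ˡ; ∈-++⁺ʳ; ∈-++⁻; ∈-deduplicate⁺; ∈-deduplicate⁻; ∈-allFin; ∈-cartesianProduct⁺)
open import Data.List.Properties using (length-map; length-removeAt′; length-++; map-++; ++-assoc; map-∘; map-cong)
open import Data.List.Relation.Binary.Subset.Propositional using (_⊆_)
open import Data.List.Relation.Binary.Subset.Propositional.Properties using (⊆-trans; ⊆-reflexive; ++⁺; map⁺)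
open import Data.List.Relation.Unary.All as All using (All; []; _∷_)
open import Data.List.Relation.Unary.All.Properties using (all⁺; all⁻)
open import Data.List.Relation.Unary.Any as Any using (Any; here; there; index)
open import Data.List.Relation.Unary.Any.Properties using (any⁻)
open import Data.List.Relation.Unary.Unique.Propositional using (Unique; _∷_)
open import Data.Maybe using (Maybe; just; nothing)
open import Data.Maybe.Properties as Maybe using (just-injective)
open import Data.Nat using (ℕ; zero; suc; _+_; _≡ᵇ_; _≤_; z≤n; s≤s)
open import Data.Nat.Properties using (≡ᵇ⇒≡; ≡⇒≡ᵇ; ≤-trans; ≤-antisym) renaming (_≟_ to _≟ℕ_)
open import Data.List.Relation.Unary.Unique.DecPropositional.Properties _≟ℕ_ using (deduplicate-!)
open import Data.Product using (Σ; _×_; _,_; proj₁; proj₂) renaming (map to ×-map)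
open import Data.Sum using (inj₁; inj₂)
open import Data.Unit using (tt)
open import Function using (_∘_; Equivalence; mk⇔)
open import Level using (0ℓ)
open import Relation.Binary.Bundles using (Setoid)
open import Relation.Binary.Definitions using (DecidableEquality)
open import Relation.Binary.PropositionalEquality
import Relation.Binary.Reasoning.Setoid as SetoidReasoning
open import Relation.Nullary using (Dec; does; yes; no)
open import Relation.Nullary.Decidable using (from-yes; _→-dec_; _×-dec_; ¬?; map′; does-⇔; dec-true; dec-false)

Gluing : Set
Gluing = Fin 4 → Fin 4

record IsPairing (τ : Gluing) : Set where
  field
    involutive      : ∀ j → τ (τ j) ≡ j
    fixedPoint-free : ∀ j → τ j ≢ j
    two-orbits      : ∀ j₀ j₁ j₂ → j₁ ≢ j₀ → j₁ ≢ τ j₀ →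
                      j₂ ≢ j₀ → j₂ ≢ τ j₀ → j₂ ≢ j₁ → j₂ ≢ τ j₁ → ⊥

isPairing? : ∀ τ → Dec (IsPairing τ)
isPairing? τ = map′ (λ (inv , fpf , orb) → record { involutive = inv ; fixedPoint-free = fpf ; two-orbits = orb })
                    (λ p → IsPairing.involutive p , IsPairing.fixedPoint-free p , IsPairing.two-orbits p)
                    (all? (λ j → τ (τ j) ≟F j) ×-dec all? (λ j → ¬? (τ j ≟F j)) ×-dec
                     all? λ j₀ → all? λ j₁ → all? λ j₂ →
                       ¬? (j₁ ≟F j₀) →-dec ¬? (j₁ ≟F τ j₀) →-dec ¬? (j₂ ≟F j₀) →-dec
                       ¬? (j₂ ≟F τ j₀) →-dec ¬? (j₂ ≟F j₁) →-dec ¬? (j₂ ≟F τ j₁) →-dec no λ ())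

tA-isPairing : IsPairing tA
tA-isPairing = from-yes (isPairing? tA)

tB-isPairing : IsPairing tB
tB-isPairing = from-yes (isPairing? tB)

tC-isPairing : IsPairing tC
tC-isPairing = from-yes (isPairing? tC)

-- Walks through removed edges

-- A removal assigns to each edge either nothing (the edge stays) or the
-- gluing with which its endpoints are traversed once the edge is removed.
Removal : ℕ → Set
Removal m = Fin m → Maybe Gluing

only : ∀ {n} → Fin (suc n) → Gluing → Removal (suc n)
only e τ i with e ≟F i
... | yes _ = just τ
... | no _  = nothing

only-here : ∀ {n} (e : Fin (suc n)) τ → only e τ e ≡ just τ
only-here e τ with e ≟F e
... | yes _  = refl
... | no e≢e = ⊥-elim (e≢e refl)

only-punchIn : ∀ {n} (e : Fin (suc n)) τ i → only e τ (punchIn e i) ≡ nothing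
only-punchIn e τ i with e ≟F punchIn e i
... | yes e≡ = ⊥-elim (punchInᵢ≢i e i (sym e≡))
... | no _   = refl

only-just : ∀ {n} (e : Fin (suc n)) τ i {σ} → only e τ i ≡ just σ → i ≡ e × σ ≡ τ
only-just e τ i eq with e ≟F i
only-just e τ i refl | yes e≡i = sym e≡i , refl

data Walk {m : ℕ} (g : Pt m → Pt m) (ρ : Removal m) : Pt m → Pt m → Set where
  stop : ∀ {i j} → ρ i ≡ nothing → Walk g ρ (i , j) (i , j)
  step : ∀ {i j τ y} → ρ i ≡ just τ → Walk g ρ (g (i , τ j)) y → Walk g ρ (i , j) y

walk-functional : ∀ {m g} {ρ : Removal m} {x y y′} → Walk g ρ x y → Walk g ρ x y′ → y ≡ y′
walk-functional (stop _) (stop _) = refl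
walk-functional (stop kept) (step removed _) with trans (sym kept) removed
... | ()
walk-functional (step removed _) (stop kept) with trans (sym removed) kept
... | ()
walk-functional (step r w) (step r′ w′) with just-injective (trans (sym r) r′)
... | refl = walk-functional w w′

walk-prepend : ∀ {n g} {ρ : Removal (suc n)} e τ → ρ e ≡ just τ →
               ∀ {x y z} → Walk g (only e τ) x y → Walk g ρ y z → Walk g ρ x z
walk-prepend e τ ρe (stop _) w = w
walk-prepend e τ ρe (step {i} r w) w′ with only-just e τ i r
... | refl , refl = step ρe (walk-prepend e τ ρe w w′)

walk-invariant : ∀ {m g} {ρ : Removal m} {A : Set} (f : Pt m → A) →
                 (∀ x → f (g x) ≡ f x) → (∀ i τ j → ρ i ≡ just τ → f (i , τ j) ≡ f (i , j)) →
                 ∀ {x y} → Walk g ρ x y → f x ≡ f y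
walk-invariant f fg fτ (stop _) = refl
walk-invariant f fg fτ (step {i} {j} {τ} r w) =
  trans (sym (fτ i τ j r)) (trans (sym (fg (i , τ j))) (walk-invariant f fg fτ w))

-- Read backwards (g and the gluings being involutions), a walk from x to y
-- is one from g y to g x.
walk-reverse : ∀ {m g} {ρ : Removal m} → (∀ x → g (g x) ≡ x) →
               (∀ i τ → ρ i ≡ just τ → ∀ j → τ (τ j) ≡ j) →
               ∀ {x y} → Walk g ρ x y → ∀ {z} → Walk g ρ (g x) z → Walk g ρ (g y) z
walk-reverse g-inv τ-inv (stop _) w′ = w′
walk-reverse {g = g} {ρ} g-inv τ-inv (step {i} {j} {τ} r w) {z} w′ =
  walk-reverse g-inv τ-inv w
    (subst (λ x → Walk g ρ x z) (sym (g-inv (i , τ j)))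
      (step r (subst (λ k → Walk g ρ (g (i , k)) z) (sym (τ-inv i τ r j)) w′)))

data View {n : ℕ} (e : Fin (suc n)) : Pt (suc n) → Set where
  here  : ∀ j → View e (e , j)
  there : ∀ (x : Pt n) → View e (punchIn e (proj₁ x) , proj₂ x)

view : ∀ {n} (e : Fin (suc n)) (y : Pt (suc n)) → View e y
view e (i , j) with e ≟F i
... | yes refl = here j
... | no e≢i   = subst (View e) (cong (_, j) (punchIn-punchOut e≢i)) (there (punchOut e≢i , j))

-- Removing one edge

module EdgeOp {n : ℕ} (τ : Gluing) (mV mB : Bool) (P : PAP (suc n)) (e : Fin (suc n)) where

  lift : Pt n → Pt (suc n)
  lift = liftPt τ mV mB P e

  lift-injective : ∀ {x y} → lift x ≡ lift y → x ≡ y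
  lift-injective {i , j} {i′ , j′} eq
    with punchIn-injective e i i′ (cong proj₁ eq) | cong proj₂ eq
  ... | refl | refl = refl

  lift≢here : ∀ x j → lift x ≢ (e , j)
  lift≢here (i , _) j eq = punchInᵢ≢i e i (cong proj₁ eq)

  exitPt-here : ∀ j → exitPt τ mV mB P e (e , j) ≡ inj₂ j
  exitPt-here j with e ≟F e
  ... | yes _  = refl
  ... | no e≢e = ⊥-elim (e≢e refl)

  exitPt-lift : ∀ x → exitPt τ mV mB P e (lift x) ≡ inj₁ x
  exitPt-lift (i , j) with e ≟F punchIn e i
  ... | yes e≡ = ⊥-elim (punchInᵢ≢i e i (sym e≡))
  ... | no _   = cong (λ k → inj₁ (k , j)) (trans (punchOut-cong e refl) (punchOut-punchIn e))

  follow-lift : ∀ fuel d x → follow τ mV mB P e fuel d (lift x) ≡ x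
  follow-lift fuel d x with exitPt τ mV mB P e (lift x) | exitPt-lift x
  ... | _ | refl = refl

  follow-here : ∀ fuel d j →
                follow τ mV mB P e (suc fuel) d (e , j) ≡ follow τ mV mB P e fuel d (gap P (e , τ j))
  follow-here fuel d j with exitPt τ mV mB P e (e , j) | exitPt-here j
  ... | _ | refl = refl

  follow-here-empty : ∀ d j → follow τ mV mB P e zero d (e , j) ≡ d
  follow-here-empty d j with exitPt τ mV mB P e (e , j) | exitPt-here j
  ... | _ | refl = refl

  ng : Pt n → Pt n
  ng = newGap τ mV mB P e

  module _ (wf : WF P) (τ-pairing : IsPairing τ) where
    open WF wf
    open IsPairing τ-pairing

    gap-swap : ∀ {x y} → gap P x ≡ y → gap P y ≡ x
    gap-swap {x} refl = gap-invol x

    -- The fuel 4 of newGap suffices: leaving w, the walk meets the endpoints of e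
    -- at most twice, since a third visit would need a third τ-orbit (route₂).
    data Route (w : Pt n) : Set where
      direct : ∀ z → gap P (lift w) ≡ lift z → ng w ≡ z → Route w
      once   : ∀ j₀ z → gap P (lift w) ≡ (e , j₀) → gap P (e , τ j₀) ≡ lift z → ng w ≡ z → Route w
      twice  : ∀ j₀ j₁ z → gap P (lift w) ≡ (e , j₀) → gap P (e , τ j₀) ≡ (e , j₁) →
               gap P (e , τ j₁) ≡ lift z → ng w ≡ z → Route w

    module _ (w : Pt n) where
      private
        fol : ℕ → Pt (suc n) → Pt n
        fol fuel = follow τ mV mB P e fuel w

      route₂ : ∀ j₀ j₁ → gap P (lift w) ≡ (e , j₀) → gap P (e , τ j₀) ≡ (e , j₁) →
               ∀ y → gap P (e , τ j₁) ≡ y → View e y → Route w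
      route₂ j₀ j₁ g₀ g₁ _ g₂ (there z) =
        twice j₀ j₁ z g₀ g₁ g₂ (begin
          fol 4 (gap P (lift w))   ≡⟨ cong (fol 4) g₀ ⟩
          fol 4 (e , j₀)           ≡⟨ follow-here 3 w j₀ ⟩
          fol 3 (gap P (e , τ j₀)) ≡⟨ cong (fol 3) g₁ ⟩
          fol 3 (e , j₁)           ≡⟨ follow-here 2 w j₁ ⟩
          fol 2 (gap P (e , τ j₁)) ≡⟨ cong (fol 2) g₂ ⟩
          fol 2 (lift z)           ≡⟨ follow-lift 2 w z ⟩
          z                        ∎)
        where open ≡-Reasoning
      route₂ j₀ j₁ g₀ g₁ _ g₂ (here j₂) =
        ⊥-elim (two-orbits j₀ j₁ j₂ j₁≢j₀ j₁≢τj₀ j₂≢j₀ j₂≢τj₀ j₂≢j₁ j₂≢τj₁)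
        where
        j₁≢j₀ : j₁ ≢ j₀
        j₁≢j₀ refl = lift≢here w (τ j₀) (trans (sym (gap-swap g₀)) (gap-swap g₁))
        j₁≢τj₀ : j₁ ≢ τ j₀
        j₁≢τj₀ refl = gap-fpf (e , j₁) g₁
        j₂≢j₀ : j₂ ≢ j₀
        j₂≢j₀ refl = lift≢here w (τ j₁) (trans (sym (gap-swap g₀)) (gap-swap g₂))
        j₂≢τj₀ : j₂ ≢ τ j₀
        j₂≢τj₀ refl = fixedPoint-free j₁ (sym (cong proj₂ (trans (sym g₁) (gap-swap g₂))))
        j₂≢j₁ : j₂ ≢ j₁
        j₂≢j₁ refl = j₁≢j₀ (trans (sym (involutive j₂))
                       (trans (cong τ (cong proj₂ (trans (sym (gap-swap g₂)) (gap-swap g₁)))) (involutive j₀)))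
        j₂≢τj₁ : j₂ ≢ τ j₁
        j₂≢τj₁ refl = gap-fpf (e , τ j₁) g₂

      route₁ : ∀ j₀ → gap P (lift w) ≡ (e , j₀) → ∀ y → gap P (e , τ j₀) ≡ y → View e y → Route w
      route₁ j₀ g₀ _ g₁ (there z) =
        once j₀ z g₀ g₁ (begin
          fol 4 (gap P (lift w))   ≡⟨ cong (fol 4) g₀ ⟩
          fol 4 (e , j₀)           ≡⟨ follow-here 3 w j₀ ⟩
          fol 3 (gap P (e , τ j₀)) ≡⟨ cong (fol 3) g₁ ⟩
          fol 3 (lift z)           ≡⟨ follow-lift 3 w z ⟩
          z                        ∎)
        where open ≡-Reasoning
      route₁ j₀ g₀ _ g₁ (here j₁) = route₂ j₀ j₁ g₀ g₁ _ refl (view e _)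

      route₀ : ∀ y → gap P (lift w) ≡ y → View e y → Route w
      route₀ _ g₀ (there z) = direct z g₀ (trans (cong (fol 4) g₀) (follow-lift 4 w z))
      route₀ _ g₀ (here j₀) = route₁ j₀ g₀ _ refl (view e _)

    route : ∀ w → Route w
    route w = route₀ w _ refl (view e _)

    newGap-walk : ∀ w → Walk (gap P) (only e τ) (gap P (lift w)) (lift (ng w))
    newGap-walk w with route w
    ... | direct z g₀ ng≡z rewrite ng≡z | g₀ = stop (only-punchIn e τ (proj₁ z))
    ... | once j₀ z g₀ g₁ ng≡z rewrite ng≡z | g₀ =
      step (only-here e τ) (subst (λ y → Walk (gap P) (only e τ) y (lift z)) (sym g₁)
        (stop (only-punchIn e τ (proj₁ z))))
    ... | twice j₀ j₁ z g₀ g₁ g₂ ng≡z rewrite ng≡z | g₀ =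
      step (only-here e τ) (subst (λ y → Walk (gap P) (only e τ) y (lift z)) (sym g₁)
        (step (only-here e τ) (subst (λ y → Walk (gap P) (only e τ) y (lift z)) (sym g₂)
          (stop (only-punchIn e τ (proj₁ z))))))

    newGap-fixedPoint-free : ∀ w → ng w ≢ w
    newGap-fixedPoint-free w ng≡w with route w
    ... | direct z g₀ refl rewrite ng≡w = gap-fpf (lift w) g₀
    ... | once j₀ z g₀ g₁ refl rewrite ng≡w = fixedPoint-free j₀ (cong proj₂ (trans (sym (gap-swap g₁)) g₀))
    ... | twice j₀ j₁ z g₀ g₁ g₂ refl rewrite ng≡w =
      gap-fpf (e , τ j₀) (trans g₁ (cong (e ,_)
        (trans (sym (involutive j₁)) (cong τ (cong proj₂ (trans (sym (gap-swap g₂)) g₀))))))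

    only-involutive : ∀ i σ → only e τ i ≡ just σ → ∀ j → σ (σ j) ≡ j
    only-involutive i σ eq with only-just e τ i eq
    ... | refl , refl = involutive

    newGap-involutive : ∀ w → ng (ng w) ≡ w
    newGap-involutive w =
      lift-injective (walk-functional (newGap-walk (ng w))
        (walk-reverse gap-invol only-involutive (newGap-walk w)
          (subst (λ y → Walk (gap P) (only e τ) y (lift w)) (sym (gap-invol (lift w)))
            (stop (only-punchIn e τ (proj₁ w))))))

    newGap-preserves : (lab : Pt (suc n) → ℕ) (F : ℕ → ℕ) → (∀ x → lab (gap P x) ≡ lab x) →
                       (∀ j → F (lab (e , τ j)) ≡ F (lab (e , j))) →
                       ∀ w → F (lab (lift (ng w))) ≡ F (lab (lift w))
    newGap-preserves lab F lab-gap lab-τ w =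
      trans (sym (walk-invariant (F ∘ lab) (cong F ∘ lab-gap) on-e (newGap-walk w)))
            (cong F (lab-gap (lift w)))
      where
      on-e : ∀ i σ j → only e τ i ≡ just σ → F (lab (i , σ j)) ≡ F (lab (i , j))
      on-e i σ j eq with only-just e τ i eq
      ... | refl , refl = lab-τ j

    edgeOp-wf : (∀ j → fV τ mV mB P e (vlab P (e , τ j)) ≡ fV τ mV mB P e (vlab P (e , j))) →
                (∀ j → fB τ mV mB P e (blab P (e , τ j)) ≡ fB τ mV mB P e (blab P (e , j))) →
                WF (edgeOp τ mV mB P e)
    edgeOp-wf vlab-τ blab-τ = record
      { gap-invol = newGap-involutive
      ; gap-fpf   = newGap-fixedPoint-free
      ; vlab-gap  = newGap-preserves (vlab P) (fV τ mV mB P e) vlab-gap vlab-τ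
      ; vlab-arr  = λ x → cong (fV τ mV mB P e) (vlab-arr (lift x))
      ; blab-gap  = newGap-preserves (blab P) (fB τ mV mB P e) blab-gap blab-τ
      ; blab-bnd  = λ x → cong (fB τ mV mB P e) (blab-bnd (lift x))
      }

-- The five operations

data Op : Set where
  deletion contraction penrose merge-deletion merge-contraction : Op

gluing : Op → Gluing
gluing deletion          = tA
gluing contraction       = tB
gluing penrose           = tC
gluing merge-deletion    = tA
gluing merge-contraction = tB

mergesV mergesB : Op → Bool
mergesV deletion          = false
mergesV contraction       = true
mergesV penrose           = true
mergesV merge-deletion    = true
mergesV merge-contraction = true
mergesB deletion          = true
mergesB contraction       = false
mergesB penrose           = true
mergesB merge-deletion    = true
mergesB merge-contraction = true

apply : ∀ {n} → Op → PAP (suc n) → Fin (suc n) → PAP n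
apply o = edgeOp (gluing o) (mergesV o) (mergesB o)

gluing-isPairing : ∀ o → IsPairing (gluing o)
gluing-isPairing deletion          = tA-isPairing
gluing-isPairing contraction       = tB-isPairing
gluing-isPairing penrose           = tC-isPairing
gluing-isPairing merge-deletion    = tA-isPairing
gluing-isPairing merge-contraction = tB-isPairing

-- fV and fB of Defs are instances of mergeIf.
mergeIf : Bool → ℕ → ℕ → ℕ → ℕ
mergeIf b from to l = if b then relabel from to l else l

relabel-from : ∀ from to → relabel from to from ≡ to
relabel-from from to with from ≡ᵇ from | ≡⇒≡ᵇ from from refl
... | true  | _ = refl

relabel-to : ∀ from to → relabel from to to ≡ to
relabel-to from to with to ≡ᵇ from
... | true  = refl
... | false = refl

mergeIf-merges : ∀ b from to → T b → mergeIf b from to from ≡ mergeIf b from to to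
mergeIf-merges true from to _ = trans (relabel-from from to) (sym (relabel-to from to))

mergeIf-absorbs : ∀ (f : ℕ → ℕ) b from to → (T b → f from ≡ f to) → ∀ l → f (mergeIf b from to l) ≡ f l
mergeIf-absorbs f false from to _ l = refl
mergeIf-absorbs f true from to f-merges l with l ≡ᵇ from | ≡ᵇ⇒≡ l from
... | true  | l≡from = trans (sym (f-merges _)) (cong f (sym (l≡from _)))
... | false | _      = refl

mergeIf-natural : ∀ b (φ : ℕ → ℕ) {from to from′ to′} → from′ ≡ φ from → to′ ≡ φ to →
                  ∀ l → mergeIf b from′ to′ (φ (mergeIf b from to l)) ≡ mergeIf b from′ to′ (φ l)
mergeIf-natural b φ {from} {to} refl refl =
  mergeIf-absorbs (mergeIf b (φ from) (φ to) ∘ φ) b from to (mergeIf-merges b (φ from) (φ to))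

module _ {n : ℕ} {P : PAP (suc n)} (wf : WF P) (e : Fin (suc n)) where
  open WF wf

  private
    u v a b : ℕ
    u = vlab P (e , zero)
    v = vlab P (e , suc (suc zero))
    a = blab P (e , zero)
    b = blab P (e , suc zero)

  merged-vlab : ∀ τ mB j → fV τ true mB P e (vlab P (e , j)) ≡ u
  merged-vlab τ mB zero                   = relabel-to v u
  merged-vlab τ mB (suc zero)             = trans (cong (relabel v u) (vlab-arr (e , zero))) (relabel-to v u)
  merged-vlab τ mB (suc (suc zero))       = relabel-from v u
  merged-vlab τ mB (suc (suc (suc zero))) = trans (cong (relabel v u) (vlab-arr (e , suc (suc zero)))) (relabel-from v u)

  merged-blab : ∀ τ mV j → fB τ mV true P e (blab P (e , j)) ≡ a
  merged-blab τ mV zero                   = relabel-to b a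
  merged-blab τ mV (suc zero)             = relabel-from b a
  merged-blab τ mV (suc (suc zero))       = trans (cong (relabel b a) (blab-bnd (e , suc zero))) (relabel-from b a)
  merged-blab τ mV (suc (suc (suc zero))) = trans (cong (relabel b a) (blab-bnd (e , zero))) (relabel-to b a)

  apply-vlab-gluing : ∀ o j → let F = fV (gluing o) (mergesV o) (mergesB o) P e in
                      F (vlab P (e , gluing o j)) ≡ F (vlab P (e , j))
  apply-vlab-gluing deletion          j = vlab-arr (e , j)
  apply-vlab-gluing merge-deletion    j = cong (fV tA true true P e) (vlab-arr (e , j))
  apply-vlab-gluing contraction       j = trans (merged-vlab tB false (tB j)) (sym (merged-vlab tB false j))
  apply-vlab-gluing penrose           j = trans (merged-vlab tC true (tC j)) (sym (merged-vlab tC true j))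
  apply-vlab-gluing merge-contraction j = trans (merged-vlab tB true (tB j)) (sym (merged-vlab tB true j))

  apply-blab-gluing : ∀ o j → let G = fB (gluing o) (mergesV o) (mergesB o) P e in
                      G (blab P (e , gluing o j)) ≡ G (blab P (e , j))
  apply-blab-gluing contraction       j = blab-bnd (e , j)
  apply-blab-gluing merge-contraction j = cong (fB tB true true P e) (blab-bnd (e , j))
  apply-blab-gluing deletion          j = trans (merged-blab tA false (tA j)) (sym (merged-blab tA false j))
  apply-blab-gluing penrose           j = trans (merged-blab tC true (tC j)) (sym (merged-blab tC true j))
  apply-blab-gluing merge-deletion    j = trans (merged-blab tA true (tA j)) (sym (merged-blab tA true j))

  apply-wf : ∀ o → WF (apply o P e)
  apply-wf o = EdgeOp.edgeOp-wf (gluing o) (mergesV o) (mergesB o) P e wf (gluing-isPairing o)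
                 (apply-vlab-gluing o) (apply-blab-gluing o)

-- Coarsenings and the definition of Q

module _ {A : Set} where

  ∈-─ : ∀ {x y : A} {xs} (x∈xs : x ∈ xs) → y ∈ xs → y ≢ x → y ∈ xs ─ x∈xs
  ∈-─ (here refl) (here refl) y≢x = ⊥-elim (y≢x refl)
  ∈-─ (here refl) (there y∈xs) _  = y∈xs
  ∈-─ (there _)   (here refl)  _  = here refl
  ∈-─ (there x∈xs) (there y∈xs) y≢x = there (∈-─ x∈xs y∈xs y≢x)

  unique-length-≤ : ∀ {xs ys : List A} → Unique xs → xs ⊆ ys → length xs ≤ length ys
  unique-length-≤ {[]} _ _ = z≤n
  unique-length-≤ {x ∷ xs} {ys} (x∉xs ∷ xs!) xs⊆ys =
    subst (suc (length xs) ≤_) (sym (length-removeAt′ ys (index x∈ys)))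
      (s≤s (unique-length-≤ xs! λ y∈xs → ∈-─ x∈ys (xs⊆ys (there y∈xs)) (≢x x∉xs y∈xs)))
    where
    x∈ys : x ∈ ys
    x∈ys = xs⊆ys (here refl)
    ≢x : ∀ {y zs} → All (x ≢_) zs → y ∈ zs → y ≢ x
    ≢x (x≢y ∷ _) (here refl) = x≢y ∘ sym
    ≢x (_ ∷ x≢zs) (there y∈zs) = ≢x x≢zs y∈zs

numBlocks-mono : ∀ {xs ys} → xs ⊆ ys → numBlocks xs ≤ numBlocks ys
numBlocks-mono {xs} xs⊆ys =
  unique-length-≤ (deduplicate-! xs) (∈-deduplicate⁺ _≟ℕ_ ∘ xs⊆ys ∘ ∈-deduplicate⁻ _≟ℕ_ xs)

numBlocks-map : ∀ (f : ℕ → ℕ) xs → numBlocks (map f xs) ≤ numBlocks xs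
numBlocks-map f xs =
  subst (numBlocks (map f xs) ≤_) (length-map f (deduplicate _≟ℕ_ xs))
    (unique-length-≤ (deduplicate-! (map f xs)) λ y∈ → into (∈-deduplicate⁻ _≟ℕ_ (map f xs) y∈))
  where
  into : ∀ {y} → y ∈ map f xs → y ∈ map f (deduplicate _≟ℕ_ xs)
  into y∈ with ∈-map⁻ f y∈
  ... | x , x∈ , refl = ∈-map⁺ f (∈-deduplicate⁺ _≟ℕ_ x∈)

-- P′ arises from P by identifying labels.
record Coarsening {m : ℕ} (P P′ : PAP m) : Set where
  field
    gap-≡      : ∀ x → gap P′ x ≡ gap P x
    φV φB      : ℕ → ℕ
    vlab-≡     : ∀ x → vlab P′ x ≡ φV (vlab P x)
    blab-≡     : ∀ x → blab P′ x ≡ φB (blab P x)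
    iso-length : length (iso P′) ≡ length (iso P)
    iso-⊆      : iso P′ ⊆ map (×-map φV φB) (iso P)

module _ (P P′ : PAP 0) (c : Coarsening P P′) where
  open Coarsening c

  |𝒱|-coarsening : |𝒱| P′ ≤ |𝒱| P
  |𝒱|-coarsening = ≤-trans (numBlocks-mono into) (numBlocks-map φV (map proj₁ (iso P)))
    where
    into : map proj₁ (iso P′) ⊆ map φV (map proj₁ (iso P))
    into y∈ with ∈-map⁻ proj₁ y∈
    ... | w , w∈ , refl with ∈-map⁻ (×-map φV φB) (iso-⊆ w∈)
    ... | u , u∈ , refl = ∈-map⁺ φV (∈-map⁺ proj₁ u∈)

  |ℬ|-coarsening : |ℬ| P′ ≤ |ℬ| P
  |ℬ|-coarsening = ≤-trans (numBlocks-mono into) (numBlocks-map φB (map proj₂ (iso P)))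
    where
    into : map proj₂ (iso P′) ⊆ map φB (map proj₂ (iso P))
    into y∈ with ∈-map⁻ proj₂ y∈
    ... | w , w∈ , refl with ∈-map⁻ (×-map φV φB) (iso-⊆ w∈)
    ... | u , u∈ , refl = ∈-map⁺ φB (∈-map⁺ proj₂ u∈)

-- The shape of newIso in Defs.
circles : {A : Set} → Bool → Bool → Bool → A → A → List A
circles b₁ b₂ b₃ x y = (if b₁ then x ∷ [] else []) ++ (if b₂ then y ∷ [] else []) ++ (if b₃ then x ∷ [] else [])

map-circles : ∀ {A B : Set} (f : A → B) b₁ b₂ b₃ x y → map f (circles b₁ b₂ b₃ x y) ≡ circles b₁ b₂ b₃ (f x) (f y)
map-circles f true  true  true  x y = refl
map-circles f true  true  false x y = refl
map-circles f true  false true  x y = refl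
map-circles f true  false false x y = refl
map-circles f false true  true  x y = refl
map-circles f false true  false x y = refl
map-circles f false false true  x y = refl
map-circles f false false false x y = refl

-- closed2 of Defs, as a function of gap P (e , τ zero).
closesVia : ∀ {n} → PAP (suc n) → Fin (suc n) → Gluing → Pt (suc n) → Bool
closesVia P e τ (i , j₁) = does (i ≟F e) ∧ not (does (j₁ ≟F zero)) ∧ not (does (j₁ ≟F τ zero))
                           ∧ does (gap P (e , τ j₁) ≟Pt (e , zero))

closed2-closesVia : ∀ {n} τ mV mB (P : PAP (suc n)) e → closed2 τ mV mB P e ≡ closesVia P e τ (gap P (e , τ zero))
closed2-closesVia τ mV mB P e with gap P (e , τ zero)
... | _ = refl

module _ {n : ℕ} (τ : Gluing) (mV mB : Bool) (P P′ : PAP (suc n)) (c : Coarsening P P′) (e : Fin (suc n)) where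
  open Coarsening c
  open EdgeOp {n} τ mV mB using (follow-lift; follow-here; follow-here-empty)

  private
    F F′ : ℕ × ℕ → ℕ × ℕ
    F  = ×-map (fV τ mV mB P e) (fB τ mV mB P e)
    F′ = ×-map (fV τ mV mB P′ e) (fB τ mV mB P′ e)
    φV′ φB′ : ℕ → ℕ
    φV′ = fV τ mV mB P′ e ∘ φV
    φB′ = fB τ mV mB P′ e ∘ φB
    φ′ : ℕ × ℕ → ℕ × ℕ
    φ′ = ×-map φV′ φB′

  follow-coarsening : ∀ fuel d y → follow τ mV mB P′ e fuel d y ≡ follow τ mV mB P e fuel d y
  follow-coarsening fuel d y with view e y
  ... | there z = trans (follow-lift P′ e fuel d z) (sym (follow-lift P e fuel d z))
  follow-coarsening zero d _ | here j = trans (follow-here-empty P′ e d j) (sym (follow-here-empty P e d j))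
  follow-coarsening (suc fuel) d _ | here j =
    trans (follow-here P′ e fuel d j) (trans (cong (follow τ mV mB P′ e fuel d) (gap-≡ (e , τ j)))
      (trans (follow-coarsening fuel d _) (sym (follow-here P e fuel d j))))

  fV-coarsening : ∀ l → fV τ mV mB P′ e (φV (fV τ mV mB P e l)) ≡ φV′ l
  fV-coarsening = mergeIf-natural mV φV (vlab-≡ (e , suc (suc zero))) (vlab-≡ (e , zero))

  fB-coarsening : ∀ l → fB τ mV mB P′ e (φB (fB τ mV mB P e l)) ≡ φB′ l
  fB-coarsening = mergeIf-natural mB φB (blab-≡ (e , suc zero)) (blab-≡ (e , zero))

  F′∘φ≗φ′∘F : ∀ u → F′ (×-map φV φB u) ≡ φ′ (F u)
  F′∘φ≗φ′∘F (v , b) = sym (cong₂ _,_ (fV-coarsening v) (fB-coarsening b))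

  newIso-coarsening : newIso τ mV mB P′ e ≡ map φ′ (newIso τ mV mB P e)
  newIso-coarsening = begin
    circles (c₁′ zero) (c₁′ s₀) c₂′ (circ′ zero) (circ′ s₀)
      ≡⟨ cong₂ (λ b₁ b₂ → circles b₁ b₂ c₂′ (circ′ zero) (circ′ s₀)) (closed1-≡ zero) (closed1-≡ s₀) ⟩
    circles (c₁ zero) (c₁ s₀) c₂′ (circ′ zero) (circ′ s₀)
      ≡⟨ cong₂ (λ b₃ x → circles (c₁ zero) (c₁ s₀) b₃ x (circ′ s₀)) closed2-≡ (circ-≡ zero) ⟩
    circles (c₁ zero) (c₁ s₀) c₂ (φ′ (circ₀ zero)) (circ′ s₀)
      ≡⟨ cong (circles (c₁ zero) (c₁ s₀) c₂ (φ′ (circ₀ zero))) (circ-≡ s₀) ⟩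
    circles (c₁ zero) (c₁ s₀) c₂ (φ′ (circ₀ zero)) (φ′ (circ₀ s₀))
      ≡⟨ map-circles φ′ (c₁ zero) (c₁ s₀) c₂ (circ₀ zero) (circ₀ s₀) ⟨
    map φ′ (newIso τ mV mB P e) ∎
    where
    open ≡-Reasoning
    s₀ : Fin 4
    s₀ = s τ mV mB P e
    c₁ c₁′ : Fin 4 → Bool
    c₁  = closed1 τ mV mB P e
    c₁′ = closed1 τ mV mB P′ e
    c₂ c₂′ : Bool
    c₂  = closed2 τ mV mB P e
    c₂′ = closed2 τ mV mB P′ e
    circ₀ circ′ : Fin 4 → ℕ × ℕ
    circ₀ = circ τ mV mB P e
    circ′ = circ τ mV mB P′ e
    closed1-≡ : ∀ j → c₁′ j ≡ c₁ j
    closed1-≡ j = cong (λ y → does (y ≟Pt (e , j))) (gap-≡ (e , τ j))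
    closesVia-≡ : ∀ y → closesVia P′ e τ y ≡ closesVia P e τ y
    closesVia-≡ (i , j₁) rewrite gap-≡ (e , τ j₁) = refl
    closed2-≡ : c₂′ ≡ c₂
    closed2-≡ = trans (closed2-closesVia τ mV mB P′ e) (trans (cong (closesVia P′ e τ) (gap-≡ (e , τ zero)))
                  (trans (closesVia-≡ (gap P (e , τ zero))) (sym (closed2-closesVia τ mV mB P e))))
    circ-≡ : ∀ j → circ′ j ≡ φ′ (circ₀ j)
    circ-≡ j = trans (cong₂ (λ v b → F′ (v , b)) (vlab-≡ (e , j)) (blab-≡ (e , j))) (F′∘φ≗φ′∘F _)

  edgeOp-coarsening : Coarsening (edgeOp τ mV mB P e) (edgeOp τ mV mB P′ e)
  edgeOp-coarsening = record
    { gap-≡      = λ x → trans (cong (follow τ mV mB P′ e 4 x) (gap-≡ _)) (follow-coarsening 4 x _)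
    ; φV         = φV′
    ; φB         = φB′
    ; vlab-≡     = λ x → trans (cong (fV τ mV mB P′ e) (vlab-≡ _)) (sym (fV-coarsening _))
    ; blab-≡     = λ x → trans (cong (fB τ mV mB P′ e) (blab-≡ _)) (sym (fB-coarsening _))
    ; iso-length = length-≡
    ; iso-⊆      = ⊆-≡
    }
    where
    open ≡-Reasoning
    length-≡ : length (map F′ (iso P′) ++ newIso τ mV mB P′ e) ≡ length (map F (iso P) ++ newIso τ mV mB P e)
    length-≡ = begin
      length (map F′ (iso P′) ++ newIso τ mV mB P′ e)            ≡⟨ length-++ (map F′ (iso P′)) ⟩
      length (map F′ (iso P′)) + length (newIso τ mV mB P′ e)     ≡⟨ cong₂ _+_ (length-map F′ (iso P′)) (cong length newIso-coarsening) ⟩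
      length (iso P′) + length (map φ′ (newIso τ mV mB P e))      ≡⟨ cong₂ _+_ iso-length (length-map φ′ (newIso τ mV mB P e)) ⟩
      length (iso P) + length (newIso τ mV mB P e)                ≡⟨ cong₂ _+_ (length-map F (iso P)) refl ⟨
      length (map F (iso P)) + length (newIso τ mV mB P e)        ≡⟨ length-++ (map F (iso P)) ⟨
      length (map F (iso P) ++ newIso τ mV mB P e)                ∎
    ⊆-≡ : map F′ (iso P′) ++ newIso τ mV mB P′ e ⊆ map φ′ (map F (iso P) ++ newIso τ mV mB P e)
    ⊆-≡ = ⊆-trans (++⁺ (⊆-trans (map⁺ F′ iso-⊆) (⊆-reflexive (begin
              map F′ (map (×-map φV φB) (iso P)) ≡⟨ map-∘ (iso P) ⟨
              map (F′ ∘ ×-map φV φB) (iso P)     ≡⟨ map-cong F′∘φ≗φ′∘F (iso P) ⟩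
              map (φ′ ∘ F) (iso P)               ≡⟨ map-∘ (iso P) ⟩
              map φ′ (map F (iso P))             ∎)))
            (⊆-reflexive newIso-coarsening))
          (⊆-reflexive (sym (map-++ φ′ (map F (iso P)) (newIso τ mV mB P e))))

≈-setoid : Setoid 0ℓ 0ℓ
≈-setoid = record
  { Carrier       = Poly
  ; _≈_           = _≈_
  ; isEquivalence = record { refl = ≈-refl ; sym = ≈-sym ; trans = ≈-trans }
  }

module ≈-Reasoning = SetoidReasoning ≈-setoid

≡⇒≈ : ∀ {p q} → p ≡ q → p ≈ q
≡⇒≈ refl = ≈-refl

expand : (Op → Poly) → Poly
expand f = 𝕒 ⊗ f deletion ⊕ 𝕓 ⊗ f contraction ⊕ 𝕔 ⊗ f penrose ⊕ 𝕩 ⊗ f merge-deletion ⊕ 𝕪 ⊗ f merge-contraction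

expand-cong : ∀ {f g} → (∀ o → f o ≈ g o) → expand f ≈ expand g
expand-cong f≈g = ⊕-cong (⊕-cong (⊕-cong (⊕-cong (⊗-cong ≈-refl (f≈g deletion)) (⊗-cong ≈-refl (f≈g contraction)))
  (⊗-cong ≈-refl (f≈g penrose))) (⊗-cong ≈-refl (f≈g merge-deletion))) (⊗-cong ≈-refl (f≈g merge-contraction))

⊕-interchange : ∀ a b c d → (a ⊕ b) ⊕ (c ⊕ d) ≈ (a ⊕ c) ⊕ (b ⊕ d)
⊕-interchange a b c d = begin
  (a ⊕ b) ⊕ (c ⊕ d) ≈⟨ ⊕-assoc a b (c ⊕ d) ⟩
  a ⊕ (b ⊕ (c ⊕ d)) ≈⟨ ⊕-cong ≈-refl (⊕-assoc b c d) ⟨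
  a ⊕ ((b ⊕ c) ⊕ d) ≈⟨ ⊕-cong ≈-refl (⊕-cong (⊕-comm b c) ≈-refl) ⟩
  a ⊕ ((c ⊕ b) ⊕ d) ≈⟨ ⊕-cong ≈-refl (⊕-assoc c b d) ⟩
  a ⊕ (c ⊕ (b ⊕ d)) ≈⟨ ⊕-assoc a c (b ⊕ d) ⟨
  (a ⊕ c) ⊕ (b ⊕ d) ∎
  where open ≈-Reasoning

⊗-left-commute : ∀ a b c → a ⊗ (b ⊗ c) ≈ b ⊗ (a ⊗ c)
⊗-left-commute a b c = begin
  a ⊗ (b ⊗ c) ≈⟨ ⊗-assoc a b c ⟨
  (a ⊗ b) ⊗ c ≈⟨ ⊗-cong (⊗-comm a b) ≈-refl ⟩
  (b ⊗ a) ⊗ c ≈⟨ ⊗-assoc b a c ⟩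
  b ⊗ (a ⊗ c) ∎
  where open ≈-Reasoning

expand-⊕ : ∀ f g → expand (λ o → f o ⊕ g o) ≈ expand f ⊕ expand g
expand-⊕ f g = begin
  expand (λ o → f o ⊕ g o)
    ≈⟨ ⊕-cong (⊕-cong (⊕-cong (⊕-cong (distribˡ 𝕒 _ _) (distribˡ 𝕓 _ _)) (distribˡ 𝕔 _ _)) (distribˡ 𝕩 _ _)) (distribˡ 𝕪 _ _) ⟩
  ((((A ⊕ A′) ⊕ (B ⊕ B′)) ⊕ (C ⊕ C′)) ⊕ (X ⊕ X′)) ⊕ (Y ⊕ Y′)
    ≈⟨ ⊕-cong (⊕-cong (⊕-cong (⊕-interchange A A′ B B′) ≈-refl) ≈-refl) ≈-refl ⟩
  ((((A ⊕ B) ⊕ (A′ ⊕ B′)) ⊕ (C ⊕ C′)) ⊕ (X ⊕ X′)) ⊕ (Y ⊕ Y′)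
    ≈⟨ ⊕-cong (⊕-cong (⊕-interchange (A ⊕ B) (A′ ⊕ B′) C C′) ≈-refl) ≈-refl ⟩
  (((A ⊕ B ⊕ C) ⊕ (A′ ⊕ B′ ⊕ C′)) ⊕ (X ⊕ X′)) ⊕ (Y ⊕ Y′)
    ≈⟨ ⊕-cong (⊕-interchange (A ⊕ B ⊕ C) (A′ ⊕ B′ ⊕ C′) X X′) ≈-refl ⟩
  ((A ⊕ B ⊕ C ⊕ X) ⊕ (A′ ⊕ B′ ⊕ C′ ⊕ X′)) ⊕ (Y ⊕ Y′)
    ≈⟨ ⊕-interchange (A ⊕ B ⊕ C ⊕ X) (A′ ⊕ B′ ⊕ C′ ⊕ X′) Y Y′ ⟩
  expand f ⊕ expand g ∎
  where
  open ≈-Reasoning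
  A B C X Y A′ B′ C′ X′ Y′ : Poly
  A  = 𝕒 ⊗ f deletion
  B  = 𝕓 ⊗ f contraction
  C  = 𝕔 ⊗ f penrose
  X  = 𝕩 ⊗ f merge-deletion
  Y  = 𝕪 ⊗ f merge-contraction
  A′ = 𝕒 ⊗ g deletion
  B′ = 𝕓 ⊗ g contraction
  C′ = 𝕔 ⊗ g penrose
  X′ = 𝕩 ⊗ g merge-deletion
  Y′ = 𝕪 ⊗ g merge-contraction

expand-⊗ : ∀ r f → expand (λ o → r ⊗ f o) ≈ r ⊗ expand f
expand-⊗ r f = begin
  expand (λ o → r ⊗ f o)
    ≈⟨ ⊕-cong (⊕-cong (⊕-cong (⊕-cong (⊗-left-commute 𝕒 r _) (⊗-left-commute 𝕓 r _))
         (⊗-left-commute 𝕔 r _)) (⊗-left-commute 𝕩 r _)) (⊗-left-commute 𝕪 r _) ⟩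
  r ⊗ (𝕒 ⊗ f deletion) ⊕ r ⊗ (𝕓 ⊗ f contraction) ⊕ r ⊗ (𝕔 ⊗ f penrose) ⊕ r ⊗ (𝕩 ⊗ f merge-deletion) ⊕ r ⊗ (𝕪 ⊗ f merge-contraction)
    ≈⟨ ⊕-cong (⊕-cong (⊕-cong (distribˡ r _ _) ≈-refl) ≈-refl) ≈-refl ⟨
  r ⊗ (𝕒 ⊗ f deletion ⊕ 𝕓 ⊗ f contraction) ⊕ r ⊗ (𝕔 ⊗ f penrose) ⊕ r ⊗ (𝕩 ⊗ f merge-deletion) ⊕ r ⊗ (𝕪 ⊗ f merge-contraction)
    ≈⟨ ⊕-cong (⊕-cong (distribˡ r _ _) ≈-refl) ≈-refl ⟨
  r ⊗ (𝕒 ⊗ f deletion ⊕ 𝕓 ⊗ f contraction ⊕ 𝕔 ⊗ f penrose) ⊕ r ⊗ (𝕩 ⊗ f merge-deletion) ⊕ r ⊗ (𝕪 ⊗ f merge-contraction)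
    ≈⟨ ⊕-cong (distribˡ r _ _) ≈-refl ⟨
  r ⊗ (𝕒 ⊗ f deletion ⊕ 𝕓 ⊗ f contraction ⊕ 𝕔 ⊗ f penrose ⊕ 𝕩 ⊗ f merge-deletion) ⊕ r ⊗ (𝕪 ⊗ f merge-contraction)
    ≈⟨ distribˡ r _ _ ⟨
  r ⊗ expand f ∎
  where open ≈-Reasoning

expand-swap : ∀ (X : Op → Op → Poly) → expand (λ k → expand (X k)) ≈ expand (λ l → expand (λ k → X k l))
expand-swap X = begin
  expand (λ k → expand (X k))
    ≈⟨ expand-⊕ (λ k → A k ⊕ B k ⊕ C k ⊕ D k) E ⟩
  expand (λ k → A k ⊕ B k ⊕ C k ⊕ D k) ⊕ expand E
    ≈⟨ ⊕-cong (expand-⊕ (λ k → A k ⊕ B k ⊕ C k) D) ≈-refl ⟩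
  expand (λ k → A k ⊕ B k ⊕ C k) ⊕ expand D ⊕ expand E
    ≈⟨ ⊕-cong (⊕-cong (expand-⊕ (λ k → A k ⊕ B k) C) ≈-refl) ≈-refl ⟩
  expand (λ k → A k ⊕ B k) ⊕ expand C ⊕ expand D ⊕ expand E
    ≈⟨ ⊕-cong (⊕-cong (⊕-cong (expand-⊕ A B) ≈-refl) ≈-refl) ≈-refl ⟩
  expand A ⊕ expand B ⊕ expand C ⊕ expand D ⊕ expand E
    ≈⟨ ⊕-cong (⊕-cong (⊕-cong (⊕-cong (expand-⊗ 𝕒 (λ k → X k deletion)) (expand-⊗ 𝕓 (λ k → X k contraction)))
         (expand-⊗ 𝕔 (λ k → X k penrose))) (expand-⊗ 𝕩 (λ k → X k merge-deletion))) (expand-⊗ 𝕪 (λ k → X k merge-contraction)) ⟩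
  expand (λ l → expand (λ k → X k l)) ∎
  where
  open ≈-Reasoning
  A B C D E : Op → Poly
  A k = 𝕒 ⊗ X k deletion
  B k = 𝕓 ⊗ X k contraction
  C k = 𝕔 ⊗ X k penrose
  D k = 𝕩 ⊗ X k merge-deletion
  E k = 𝕪 ⊗ X k merge-contraction

Q : ∀ {m} → PAP m → Poly
Q {zero}  P = (𝛼 ^ |V| P) ⊗ (𝛽 ^ |𝒱| P) ⊗ (𝛾 ^ |ℬ| P)
Q {suc n} P = expand (λ o → Q (apply o P zero))

Q-cong : ∀ {m} {P P′ : PAP m} → Coarsening P P′ → Coarsening P′ P → Q P ≈ Q P′
Q-cong {zero} {P} {P′} c c′ = ≡⇒≈ (cong₂ _⊗_
  (cong₂ _⊗_ (cong (𝛼 ^_) (sym (Coarsening.iso-length c)))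
             (cong (𝛽 ^_) (≤-antisym (|𝒱|-coarsening P′ P c′) (|𝒱|-coarsening P P′ c))))
  (cong (𝛾 ^_) (≤-antisym (|ℬ|-coarsening P′ P c′) (|ℬ|-coarsening P P′ c))))
Q-cong {suc n} {P} {P′} c c′ = expand-cong λ o →
  Q-cong (edgeOp-coarsening (gluing o) (mergesV o) (mergesB o) P P′ c zero)
         (edgeOp-coarsening (gluing o) (mergesV o) (mergesB o) P′ P c′ zero)

-- Two edges: gaps and labels

module _ {m : ℕ} (τ : Gluing) (mV mB : Bool) (P : PAP (suc m)) (wf : WF P) (τ-pairing : IsPairing τ)
         (e : Fin (suc m)) {ρ′ : Removal m} {ρ : Removal (suc m)}
         (ρe : ρ e ≡ just τ) (ρ-punchIn : ∀ i → ρ (punchIn e i) ≡ ρ′ i) where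
  open EdgeOp τ mV mB P e using (lift; newGap-walk)

  walk-lift : ∀ {x y} → Walk (gap (edgeOp τ mV mB P e)) ρ′ x y → Walk (gap P) ρ (lift x) (lift y)
  walk-lift (stop {i} kept) = stop (trans (ρ-punchIn i) kept)
  walk-lift (step {i} {j} {σ} removed w) =
    step (trans (ρ-punchIn i) removed) (walk-prepend e τ ρe (newGap-walk wf τ-pairing (i , σ j)) (walk-lift w))

  walk-edgeOp : ∀ x {y} → Walk (gap (edgeOp τ mV mB P e)) ρ′ (gap (edgeOp τ mV mB P e) x) y →
                Walk (gap P) ρ (gap P (lift x)) (lift y)
  walk-edgeOp x w = walk-prepend e τ ρe (newGap-walk wf τ-pairing x) (walk-lift w)

-- Both orders of removing edges 0 and e + 1 produce the gap given by the
-- walk in P that crosses both edges.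
module _ {n : ℕ} (P : PAP (suc (suc n))) (wf : WF P) (e : Fin (suc n)) (k l : Op) where
  private
    both : Removal (suc (suc n))
    both zero    = just (gluing k)
    both (suc i) = only e (gluing l) i

    both-punchIn : ∀ i → both (punchIn (suc e) i) ≡ only zero (gluing k) i
    both-punchIn zero    = refl
    both-punchIn (suc i) = only-punchIn e (gluing l) i

    lift₂ : Pt n → Pt (suc (suc n))
    lift₂ (i , j) = (suc (punchIn e i) , j)

    lift₂-injective : ∀ {x y} → lift₂ x ≡ lift₂ y → x ≡ y
    lift₂-injective eq with punchIn-injective e _ _ (suc-injective (cong proj₁ eq)) | cong proj₂ eq
    ... | refl | refl = refl

  apply-apply-gap : ∀ x → gap (apply l (apply k P zero) e) x ≡ gap (apply k (apply l P (suc e)) zero) x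
  apply-apply-gap x = lift₂-injective (walk-functional k-first l-first)
    where
    k-first : Walk (gap P) both (gap P (lift₂ x)) (lift₂ (gap (apply l (apply k P zero) e) x))
    k-first = walk-edgeOp (gluing k) (mergesV k) (mergesB k) P wf (gluing-isPairing k) zero refl (λ _ → refl)
                (punchIn e (proj₁ x) , proj₂ x)
                (EdgeOp.newGap-walk (gluing l) (mergesV l) (mergesB l) (apply k P zero) e
                   (apply-wf wf zero k) (gluing-isPairing l) x)
    l-first : Walk (gap P) both (gap P (lift₂ x)) (lift₂ (gap (apply k (apply l P (suc e)) zero) x))
    l-first = walk-edgeOp (gluing l) (mergesV l) (mergesB l) P wf (gluing-isPairing l) (suc e)
                (only-here e (gluing l)) both-punchIn (suc (proj₁ x) , proj₂ x)
                (EdgeOp.newGap-walk (gluing k) (mergesV k) (mergesB k) (apply l P (suc e)) zero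
                   (apply-wf wf (suc e) l) (gluing-isPairing k) x)

mergeTwice : Bool → Bool → ℕ → ℕ → ℕ → ℕ → ℕ → ℕ
mergeTwice b₁ b₂ from₁ to₁ from₂ to₂ = mergeIf b₂ (first from₂) (first to₂) ∘ first
  where
  first : ℕ → ℕ
  first = mergeIf b₁ from₁ to₁

mergeTwice-absorbs : ∀ b₁ b₂ from₁ to₁ from₂ to₂ l →
                     mergeTwice b₁ b₂ from₁ to₁ from₂ to₂ (mergeTwice b₂ b₁ from₂ to₂ from₁ to₁ l)
                     ≡ mergeTwice b₁ b₂ from₁ to₁ from₂ to₂ l
mergeTwice-absorbs b₁ b₂ from₁ to₁ from₂ to₂ l =
  trans (mergeIf-absorbs f b₁ (r₂ from₁) (r₂ to₁) f-merges₁′ (r₂ l)) (f∘r₂ l)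
  where
  f r₁ r₂ : ℕ → ℕ
  f  = mergeTwice b₁ b₂ from₁ to₁ from₂ to₂
  r₁ = mergeIf b₁ from₁ to₁
  r₂ = mergeIf b₂ from₂ to₂
  f∘r₂ : ∀ l → f (r₂ l) ≡ f l
  f∘r₂ = mergeIf-absorbs f b₂ from₂ to₂ (mergeIf-merges b₂ (r₁ from₂) (r₁ to₂))
  f-merges₁′ : T b₁ → f (r₂ from₁) ≡ f (r₂ to₁)
  f-merges₁′ t = trans (f∘r₂ from₁)
    (trans (cong (mergeIf b₂ (r₁ from₂) (r₁ to₂)) (mergeIf-merges b₁ from₁ to₁ t)) (sym (f∘r₂ to₁)))

-- Two edges: the circles created, checked exhaustively

-- Boolean equalities that evaluate fast in the exhaustive check below; each
-- agrees with a decidable equality of the standard library.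
_=ᶠ_ : ∀ {k} → Fin k → Fin k → Bool
zero  =ᶠ zero  = true
suc a =ᶠ suc b = a =ᶠ b
zero  =ᶠ suc _ = false
suc _ =ᶠ zero  = false

=ᶠ-does : ∀ {k} (a b : Fin k) → (a =ᶠ b) ≡ does (a ≟F b)
=ᶠ-does zero    zero    = refl
=ᶠ-does zero    (suc b) = refl
=ᶠ-does (suc a) zero    = refl
=ᶠ-does (suc a) (suc b) = =ᶠ-does a b

_=ᴾ_ : ∀ {m} → Pt m → Pt m → Bool
(i , j) =ᴾ (i′ , j′) = (i =ᶠ i′) ∧ (j =ᶠ j′)

=ᴾ-does : ∀ {m} (x y : Pt m) → (x =ᴾ y) ≡ does (x ≟Pt y)
=ᴾ-does (i , j) (i′ , j′) with i ≟F i′ | =ᶠ-does i i′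
... | yes refl | i=i rewrite i=i = =ᶠ-does j j′
... | no _     | i=i′ rewrite i=i′ = refl

liftEq : ∀ {A : Set} → (A → A → Bool) → Maybe A → Maybe A → Bool
liftEq _==_ nothing  nothing  = true
liftEq _==_ (just x) (just y) = x == y
liftEq _==_ nothing  (just _) = false
liftEq _==_ (just _) nothing  = false

liftEq-does : ∀ {A : Set} {_==_ : A → A → Bool} {_≟_ : DecidableEquality A} →
              (∀ x y → (x == y) ≡ does (x ≟ y)) → ∀ m m′ → liftEq _==_ m m′ ≡ does (Maybe.≡-dec _≟_ m m′)
liftEq-does ==-does nothing  nothing  = refl
liftEq-does ==-does (just x) (just y) = ==-does x y
liftEq-does ==-does nothing  (just _) = refl
liftEq-does ==-does (just _) nothing  = refl

_=ᴸ_ : ∀ {m} → Maybe (Pt m) → Maybe (Pt m) → Bool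
_=ᴸ_ = liftEq _=ᴾ_

==-sound : ∀ {A : Set} {_==_ : A → A → Bool} (_≟_ : DecidableEquality A) →
           (∀ x y → (x == y) ≡ does (x ≟ y)) → ∀ x y → T (x == y) → x ≡ y
==-sound _≟_ ==-does x y t with x ≟ y | ==-does x y
... | yes x≡y | _ = x≡y
... | no _    | eq = ⊥-elim (subst T eq t)

=ᴸ-does : ∀ {m} (x y : Maybe (Pt m)) → (x =ᴸ y) ≡ does (Maybe.≡-dec _≟Pt_ x y)
=ᴸ-does = liftEq-does =ᴾ-does

-- Endpoints of two edges: (zero , j) on the edge removed first, (suc zero , j)
-- on the other one.
Local : Set
Local = Pt 2

-- The gap restricted to the two edges; nothing when it leaves them.
LocalGap : Set
LocalGap = Local → Maybe Local

_=ᴶ_ : Maybe (Fin 4) → Maybe (Fin 4) → Bool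
_=ᴶ_ = liftEq _=ᶠ_

-- s of Defs.
partner : Gluing → Fin 4
partner τ = if does (τ zero ≟F suc zero) then suc (suc zero) else suc zero

-- The circles created by removing the first edge (gluing τ₁) and then the
-- second one (gluing τ₂), computed from the local gap only: a transcription
-- of closed1 / closed2 of Defs, where gap₁ is the new gap at the second edge.
module LocalModel (τ₁ τ₂ : Gluing) (g : LocalGap) where

  closesAlone₁ : Fin 4 → Bool
  closesAlone₁ j = g (zero , τ₁ j) =ᴸ just (zero , j)

  closesVia₁ : Maybe Local → Bool
  closesVia₁ nothing          = false
  closesVia₁ (just (i , j₁)) = (i =ᶠ zero) ∧ not (j₁ =ᶠ zero) ∧ not (j₁ =ᶠ τ₁ zero)
                               ∧ (g (zero , τ₁ j₁) =ᴸ just (zero , zero))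

  follow₁ : ℕ → Maybe (Fin 4) → Maybe Local → Maybe (Fin 4)
  follow₁ _          d nothing                = nothing
  follow₁ _          d (just (suc zero , j)) = just j
  follow₁ zero       d (just (zero , j))     = d
  follow₁ (suc fuel) d (just (zero , j))     = follow₁ fuel d (g (zero , τ₁ j))

  gap₁ : Fin 4 → Maybe (Fin 4)
  gap₁ j = follow₁ 4 (just j) (g (suc zero , j))

  closesAlone₂ : Fin 4 → Bool
  closesAlone₂ j = gap₁ (τ₂ j) =ᴶ just j

  closesVia₂ : Maybe (Fin 4) → Bool
  closesVia₂ nothing   = false
  closesVia₂ (just j₁) = not (j₁ =ᶠ zero) ∧ not (j₁ =ᶠ τ₂ zero) ∧ (gap₁ (τ₂ j₁) =ᴶ just zero)

  newCircles : List Local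
  newCircles = circles (closesAlone₁ zero) (closesAlone₁ (partner τ₁)) (closesVia₁ (g (zero , τ₁ zero)))
                       (zero , zero) (zero , partner τ₁)
            ++ circles (closesAlone₂ zero) (closesAlone₂ (partner τ₂)) (closesVia₂ (gap₁ (τ₂ zero)))
                       (suc zero , zero) (suc zero , partner τ₂)

swapSide : Fin 2 → Fin 2
swapSide zero       = suc zero
swapSide (suc zero) = zero

swap : Local → Local
swap (i , j) = (swapSide i , j)

swapGap : LocalGap → LocalGap
swapGap g p = Data.Maybe.map swap (g (swap p))

module Connectivity (τ₁ τ₂ : Gluing) (g : LocalGap) where

  glue : Local → Local
  glue (zero , j)     = (zero , τ₁ j)
  glue (suc zero , j) = (suc zero , τ₂ j)

  next : Local → Local
  next p with g p
  ... | just q  = glue q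
  ... | nothing = p

  connected : ℕ → Local → Local → Bool
  connected zero       p q = false
  connected (suc fuel) p q = (p =ᴾ q) ∨ (g p =ᴸ just q) ∨ connected fuel (next p) q

  connected-invariant : ∀ {A : Set} (lab : Local → A) → (∀ p q → g p ≡ just q → lab q ≡ lab p) →
                        (∀ p → lab (glue p) ≡ lab p) → ∀ fuel p q → T (connected fuel p q) → lab p ≡ lab q
  connected-invariant lab lab-g lab-glue (suc fuel) p q t with Equivalence.to T-∨ t
  ... | inj₁ p=q = cong lab (==-sound _≟Pt_ =ᴾ-does p q p=q)
  ... | inj₂ t′ with Equivalence.to (T-∨ {g p =ᴸ just q}) t′
  ...   | inj₁ gp=q = sym (lab-g p q (==-sound (Maybe.≡-dec _≟Pt_) =ᴸ-does (g p) (just q) gp=q))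
  ...   | inj₂ t″ = trans (sym lab-next) (connected-invariant lab lab-g lab-glue fuel (next p) q t″)
    where
    lab-next : lab (next p) ≡ lab p
    lab-next with g p in gp
    ... | just r  = trans (lab-glue r) (lab-g p r gp)
    ... | nothing = refl

record IsLocalGap (g : LocalGap) : Set where
  field
    irreflexive : ∀ p → g p ≢ just p
    symmetric   : ∀ p q → g p ≡ just q → g q ≡ just p

Assignment : Set
Assignment = List (Local × Maybe Local)

toGap : Assignment → LocalGap
toGap []            p = nothing
toGap ((q , v) ∷ a) p = if p =ᴾ q then v else toGap a p

-- Extending an assignment by p ↦ v keeps it a partial fixed-point-free involution.
consistent : Local → Maybe Local → Assignment → Bool
consistent p v a = not (v =ᴸ just p) ∧ all (λ (q , w) → not ((v =ᴸ just q) xor (w =ᴸ just p))) a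

locals : List Local
locals = cartesianProduct (allFin 2) (allFin 4)

candidates : List (Maybe Local)
candidates = nothing ∷ map just locals

-- Runs f on every partial fixed-point-free involution of Local, pruning
-- inconsistent prefixes.
search : (LocalGap → Bool) → List Local → Assignment → Bool
search f []       a = f (toGap a)
search f (p ∷ ps) a = all (λ v → not (consistent p v a) ∨ search f ps ((p , v) ∷ a)) candidates

-- Both orders create equally many circles, each lying on the gap/gluing cycle
-- of one created in the other order (the second order computed in swapped
-- coordinates).  Opaque, as are tabulate and the checks using them: unfolding
-- these in types makes Agda normalise the whole check.
opaque
  matches : Gluing → Gluing → LocalGap → Bool
  matches τ₁ τ₂ g = (length L ≡ᵇ length R) ∧ all (λ p → any (connected 8 p) R) L ∧ all (λ q → any (connected 8 q) L) R
    where
    open Connectivity τ₁ τ₂ g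
    L R : List Local
    L = LocalModel.newCircles τ₁ τ₂ g
    R = map swap (LocalModel.newCircles τ₂ τ₁ (swapGap g))

module _ {τ₁ τ₂ : Gluing} {g : LocalGap} where
  open Connectivity τ₁ τ₂ g

  record Matching : Set where
    field
      same-length : length (LocalModel.newCircles τ₁ τ₂ g) ≡ length (map swap (LocalModel.newCircles τ₂ τ₁ (swapGap g)))
      first⊆second : All (λ p → Any (T ∘ connected 8 p) (map swap (LocalModel.newCircles τ₂ τ₁ (swapGap g))))
                         (LocalModel.newCircles τ₁ τ₂ g)
      second⊆first : All (λ q → Any (T ∘ connected 8 q) (LocalModel.newCircles τ₁ τ₂ g))
                         (map swap (LocalModel.newCircles τ₂ τ₁ (swapGap g)))

  opaque
    unfolding matches

    matches-sound : T (matches τ₁ τ₂ g) → Matching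
    matches-sound t with Equivalence.to T-∧ t
    ... | same , t′ with Equivalence.to T-∧ t′
    ...   | first , second = record
      { same-length  = ≡ᵇ⇒≡ _ _ same
      ; first⊆second = All.map (any⁻ _ _) (all⁺ _ _ first)
      ; second⊆first = All.map (any⁻ _ _) (all⁺ _ _ second)
      }

Agrees : LocalGap → Assignment → Set
Agrees g = All (λ (q , w) → w ≡ g q)

fill : LocalGap → List Local → Assignment → Assignment
fill g []       a = a
fill g (p ∷ ps) a = fill g ps ((p , g p) ∷ a)

toGap-fill : ∀ g p → toGap (fill g locals []) p ≡ g p
toGap-fill g (zero , zero)                         = refl
toGap-fill g (zero , suc zero)                     = refl
toGap-fill g (zero , suc (suc zero))               = refl
toGap-fill g (zero , suc (suc (suc zero)))         = refl
toGap-fill g (suc zero , zero)                     = refl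
toGap-fill g (suc zero , suc zero)                 = refl
toGap-fill g (suc zero , suc (suc zero))           = refl
toGap-fill g (suc zero , suc (suc (suc zero)))     = refl

candidates-complete : ∀ v → v ∈ candidates
candidates-complete nothing        = here refl
candidates-complete (just (i , j)) = there (∈-map⁺ just (∈-cartesianProduct⁺ (∈-allFin i) (∈-allFin j)))

consistent-sound : ∀ {g} → IsLocalGap g → ∀ p {a} → Agrees g a → T (consistent p (g p) a)
consistent-sound {g} isGap p {a} agrees = Equivalence.from T-∧ (not-loop , all⁻ _ (All.map symmetric-pair agrees))
  where
  open IsLocalGap isGap
  not-loop : T (not (g p =ᴸ just p))
  not-loop rewrite =ᴸ-does (g p) (just p) | dec-false (Maybe.≡-dec _≟Pt_ (g p) (just p)) (irreflexive p) = tt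
  symmetric-pair : ∀ {(q , w) : Local × Maybe Local} → w ≡ g q → T (not ((g p =ᴸ just q) xor (w =ᴸ just p)))
  symmetric-pair {q , w} refl
    rewrite =ᴸ-does (g p) (just q) | =ᴸ-does (g q) (just p)
          | does-⇔ (mk⇔ (symmetric p q) (symmetric q p)) (Maybe.≡-dec _≟Pt_ (g p) (just q)) (Maybe.≡-dec _≟Pt_ (g q) (just p))
          | xor-same (does (Maybe.≡-dec _≟Pt_ (g q) (just p))) = tt

search-sound : ∀ f ps a → T (search f ps a) → ∀ {g} → IsLocalGap g → Agrees g a → T (f (toGap (fill g ps a)))
search-sound f []       a t isGap agrees = t
search-sound f (p ∷ ps) a t {g} isGap agrees = search-sound f ps ((p , g p) ∷ a) extended isGap (refl ∷ agrees)
  where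
  extended : T (search f ps ((p , g p) ∷ a))
  extended with consistent p (g p) a | consistent-sound isGap p agrees
                | All.lookup (all⁺ (λ v → not (consistent p v a) ∨ search f ps ((p , v) ∷ a)) candidates t)
                             (candidates-complete (g p))
  ... | true | _ | t′ = t′

gluings : List Gluing
gluings = tA ∷ tB ∷ tC ∷ []

matchesPair : LocalGap → Gluing × Gluing → Bool
matchesPair g (τ₁ , τ₂) = matches τ₁ τ₂ g

matchesAll : LocalGap → Bool
matchesAll g = all (matchesPair g) (cartesianProduct gluings gluings)

opaque
  unfolding matches

  all-local-gaps-match : search matchesAll locals [] ≡ true
  all-local-gaps-match = refl

gluing-∈ : ∀ o → gluing o ∈ gluings
gluing-∈ deletion          = here refl
gluing-∈ contraction       = there (here refl)
gluing-∈ penrose           = there (there (here refl))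
gluing-∈ merge-deletion    = here refl
gluing-∈ merge-contraction = there (here refl)

opaque
  tabulate : LocalGap → LocalGap
  tabulate g = toGap (fill g locals [])

  tabulate-spec : ∀ g p → tabulate g p ≡ g p
  tabulate-spec = toGap-fill

opaque
  unfolding tabulate

  local-gaps-match : ∀ k l {g} → IsLocalGap g → Matching {gluing k} {gluing l} {tabulate g}
  local-gaps-match k l {g} isGap =
    matches-sound {gluing k} {gluing l} {toGap (fill g locals [])}
      (All.lookup (all⁺ (matchesPair (toGap (fill g locals []))) (cartesianProduct gluings gluings)
                        (search-sound matchesAll locals [] (subst T (sym all-local-gaps-match) tt) isGap []))
                  (∈-cartesianProduct⁺ (gluing-∈ k) (gluing-∈ l)))

-- Two edges: from P to its local gap

labels : ∀ {m} → PAP m → Pt m → ℕ × ℕ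
labels P x = (vlab P x , blab P x)

-- Remove edge a of P (operation k), then edge b′ of the result (operation l),
-- where b′ is the index of b = punchIn a b′ after the first removal.
module TwoEdges {n : ℕ} (P : PAP (suc (suc n))) (wf : WF P) (a : Fin (suc (suc n))) (b′ : Fin (suc n)) where
  open WF wf

  b : Fin (suc (suc n))
  b = punchIn a b′

  loc : Local → Pt (suc (suc n))
  loc (zero , j)     = (a , j)
  loc (suc zero , j) = (b , j)

  cls : Pt (suc (suc n)) → Maybe Local
  cls (i , j) = if does (i ≟F a) then just (zero , j) else if does (i ≟F b) then just (suc zero , j) else nothing

  cls-loc : ∀ p → cls (loc p) ≡ just p
  cls-loc (zero , j) rewrite dec-true (a ≟F a) refl = refl
  cls-loc (suc zero , j) rewrite dec-false (b ≟F a) (punchInᵢ≢i a b′) | dec-true (b ≟F b) refl = refl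

  cls-just : ∀ y q → cls y ≡ just q → y ≡ loc q
  cls-just (i , j) q eq with i ≟F a | i ≟F b
  cls-just (i , j) _ refl | yes refl | _      = refl
  cls-just (i , j) _ refl | no _     | yes refl = refl

  does-≟loc : ∀ y q → does (y ≟Pt loc q) ≡ (cls y =ᴸ just q)
  does-≟loc y q = trans (does-⇔ (mk⇔ (λ { refl → cls-loc q }) (cls-just y q))
                                (y ≟Pt loc q) (Maybe.≡-dec _≟Pt_ (cls y) (just q)))
                        (sym (=ᴸ-does (cls y) (just q)))

  cls-punchIn : ∀ i j → cls (punchIn a i , j) ≡ (if does (i ≟F b′) then just (suc zero , j) else nothing)
  cls-punchIn i j
    rewrite dec-false (punchIn a i ≟F a) (punchInᵢ≢i a i)
          | does-⇔ (mk⇔ (punchIn-injective a i b′) (cong (punchIn a))) (punchIn a i ≟F b) (i ≟F b′) = refl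

  labels-gap : ∀ {x y} → gap P x ≡ y → labels P y ≡ labels P x
  labels-gap {x} refl = cong₂ _,_ (vlab-gap x) (blab-gap x)

  module _ (k l : Op) where

    ΦV ΦB : ℕ → ℕ
    ΦV = mergeTwice (mergesV k) (mergesV l) (vlab P (a , suc (suc zero))) (vlab P (a , zero))
                                            (vlab P (b , suc (suc zero))) (vlab P (b , zero))
    ΦB = mergeTwice (mergesB k) (mergesB l) (blab P (a , suc zero)) (blab P (a , zero))
                                            (blab P (b , suc zero)) (blab P (b , zero))

    Φ : ℕ × ℕ → ℕ × ℕ
    Φ = ×-map ΦV ΦB

    Φ-glue-first : ∀ j → Φ (labels P (a , gluing k j)) ≡ Φ (labels P (a , j))
    Φ-glue-first j = cong (×-map (fV (gluing l) (mergesV l) (mergesB l) (apply k P a) b′)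
                                 (fB (gluing l) (mergesV l) (mergesB l) (apply k P a) b′))
                          (cong₂ _,_ (apply-vlab-gluing wf a k j) (apply-blab-gluing wf a k j))

    Φ-glue-second : ∀ j → Φ (labels P (b , gluing l j)) ≡ Φ (labels P (b , j))
    Φ-glue-second j = cong₂ _,_ (apply-vlab-gluing (apply-wf wf a k) b′ l j) (apply-blab-gluing (apply-wf wf a k) b′ l j)

  module _ (k l : Op) (g : LocalGap) (g-spec : ∀ p → g p ≡ cls (gap P (loc p))) where
    open LocalModel (gluing k) (gluing l) g

    private
      τ₁ τ₂ : Gluing
      τ₁ = gluing k
      τ₂ = gluing l
      P₁ : PAP (suc n)
      P₁ = apply k P a

    closed1-first : ∀ j → closed1 τ₁ (mergesV k) (mergesB k) P a j ≡ closesAlone₁ j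
    closed1-first j = trans (does-≟loc (gap P (a , τ₁ j)) (zero , j)) (cong (_=ᴸ just (zero , j)) (sym (g-spec (zero , τ₁ j))))

    closesVia-first : ∀ y → closesVia P a τ₁ y ≡ closesVia₁ (cls y)
    closesVia-first (i , j₁) with i ≟F a
    ... | yes refl rewrite =ᶠ-does j₁ zero | =ᶠ-does j₁ (τ₁ zero) | does-≟loc (gap P (a , τ₁ j₁)) (zero , zero)
                         | g-spec (zero , τ₁ j₁) = refl
    ... | no _ with does (i ≟F b)
    ...   | true  = refl
    ...   | false = refl

    closed2-first : closed2 τ₁ (mergesV k) (mergesB k) P a ≡ closesVia₁ (g (zero , τ₁ zero))
    closed2-first = trans (closed2-closesVia τ₁ (mergesV k) (mergesB k) P a)
                      (trans (closesVia-first (gap P (a , τ₁ zero))) (cong closesVia₁ (sym (g-spec (zero , τ₁ zero)))))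

    cls₂ : Pt (suc n) → Maybe (Fin 4)
    cls₂ (i , j) = if does (i ≟F b′) then just j else nothing

    cls₂-here : ∀ j → cls₂ (b′ , j) ≡ just j
    cls₂-here j rewrite dec-true (b′ ≟F b′) refl = refl

    follow-first : ∀ fuel d y → cls₂ (follow τ₁ (mergesV k) (mergesB k) P a fuel d y) ≡ follow₁ fuel (cls₂ d) (cls y)
    follow-first fuel d y with view a y
    follow-first zero d _ | here j rewrite cls-loc (zero , j) =
      cong cls₂ (EdgeOp.follow-here-empty τ₁ (mergesV k) (mergesB k) P a d j)
    follow-first (suc fuel) d _ | here j rewrite cls-loc (zero , j) = begin
      cls₂ (follow τ₁ (mergesV k) (mergesB k) P a (suc fuel) d (a , j))
        ≡⟨ cong cls₂ (EdgeOp.follow-here τ₁ (mergesV k) (mergesB k) P a fuel d j) ⟩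
      cls₂ (follow τ₁ (mergesV k) (mergesB k) P a fuel d (gap P (a , τ₁ j)))
        ≡⟨ follow-first fuel d (gap P (a , τ₁ j)) ⟩
      follow₁ fuel (cls₂ d) (cls (gap P (a , τ₁ j)))
        ≡⟨ cong (follow₁ fuel (cls₂ d)) (g-spec (zero , τ₁ j)) ⟨
      follow₁ fuel (cls₂ d) (g (zero , τ₁ j)) ∎
      where open ≡-Reasoning
    follow-first fuel d _ | there (i , j)
      rewrite EdgeOp.follow-lift τ₁ (mergesV k) (mergesB k) P a fuel d (i , j) | cls-punchIn i j
      with does (i ≟F b′)
    ... | true  = refl
    ... | false = refl

    gap₁-spec : ∀ j → cls₂ (gap P₁ (b′ , j)) ≡ gap₁ j
    gap₁-spec j = trans (follow-first 4 (b′ , j) (gap P (b , j)))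
                        (cong₂ (follow₁ 4) (cls₂-here j) (sym (g-spec (suc zero , j))))

    does-≟here₂ : ∀ r j → does (r ≟Pt (b′ , j)) ≡ (cls₂ r =ᴶ just j)
    does-≟here₂ r j = trans (does-⇔ (mk⇔ (λ { refl → cls₂-here j }) (back r))
                                    (r ≟Pt (b′ , j)) (Maybe.≡-dec _≟F_ (cls₂ r) (just j)))
                            (sym (liftEq-does =ᶠ-does (cls₂ r) (just j)))
      where
      back : ∀ r → cls₂ r ≡ just j → r ≡ (b′ , j)
      back (i , j′) eq with i ≟F b′
      back (i , j′) refl | yes refl = refl

    closed1-second : ∀ j → closed1 τ₂ (mergesV l) (mergesB l) P₁ b′ j ≡ closesAlone₂ j
    closed1-second j = trans (does-≟here₂ (gap P₁ (b′ , τ₂ j)) j) (cong (_=ᴶ just j) (gap₁-spec (τ₂ j)))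

    closesVia-second : ∀ r → closesVia P₁ b′ τ₂ r ≡ closesVia₂ (cls₂ r)
    closesVia-second (i , j₁) with i ≟F b′
    ... | yes refl rewrite =ᶠ-does j₁ zero | =ᶠ-does j₁ (τ₂ zero) | does-≟here₂ (gap P₁ (b′ , τ₂ j₁)) zero
                         | gap₁-spec (τ₂ j₁) = refl
    ... | no _ = refl

    closed2-second : closed2 τ₂ (mergesV l) (mergesB l) P₁ b′ ≡ closesVia₂ (gap₁ (τ₂ zero))
    closed2-second = trans (closed2-closesVia τ₂ (mergesV l) (mergesB l) P₁ b′)
                       (trans (closesVia-second (gap P₁ (b′ , τ₂ zero))) (cong closesVia₂ (gap₁-spec (τ₂ zero))))

    private
      C₁ C₂ : List Local
      C₁ = circles (closesAlone₁ zero) (closesAlone₁ (partner τ₁)) (closesVia₁ (g (zero , τ₁ zero)))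
                   (zero , zero) (zero , partner τ₁)
      C₂ = circles (closesAlone₂ zero) (closesAlone₂ (partner τ₂)) (closesVia₂ (gap₁ (τ₂ zero)))
                   (suc zero , zero) (suc zero , partner τ₂)
      F₁ : ℕ × ℕ → ℕ × ℕ
      F₁ = ×-map (fV τ₁ (mergesV k) (mergesB k) P a) (fB τ₁ (mergesV k) (mergesB k) P a)
      F₂ : ℕ × ℕ → ℕ × ℕ
      F₂ = ×-map (fV τ₂ (mergesV l) (mergesB l) P₁ b′) (fB τ₂ (mergesV l) (mergesB l) P₁ b′)
      N₁ N₂ : List (ℕ × ℕ)
      N₁ = newIso τ₁ (mergesV k) (mergesB k) P a
      N₂ = newIso τ₂ (mergesV l) (mergesB l) P₁ b′

    newIso-first : map F₂ N₁ ≡ map (Φ k l ∘ labels P ∘ loc) C₁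
    newIso-first = begin
      map F₂ (circles (c₁ zero) (c₁ (partner τ₁)) c₂ (circ τ₁ mV mB P a zero) (circ τ₁ mV mB P a (partner τ₁)))
        ≡⟨ map-circles F₂ (c₁ zero) (c₁ (partner τ₁)) c₂ (circ τ₁ mV mB P a zero) (circ τ₁ mV mB P a (partner τ₁)) ⟩
      circles (c₁ zero) (c₁ (partner τ₁)) c₂ (ℓ zero) (ℓ (partner τ₁))
        ≡⟨ cong₂ (λ c c′ → circles c c′ c₂ (ℓ zero) (ℓ (partner τ₁))) (closed1-first zero) (closed1-first (partner τ₁)) ⟩
      circles (closesAlone₁ zero) (closesAlone₁ (partner τ₁)) c₂ (ℓ zero) (ℓ (partner τ₁))
        ≡⟨ cong (λ c → circles (closesAlone₁ zero) (closesAlone₁ (partner τ₁)) c (ℓ zero) (ℓ (partner τ₁))) closed2-first ⟩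
      circles (closesAlone₁ zero) (closesAlone₁ (partner τ₁)) (closesVia₁ (g (zero , τ₁ zero))) (ℓ zero) (ℓ (partner τ₁))
        ≡⟨ map-circles (Φ k l ∘ labels P ∘ loc) (closesAlone₁ zero) (closesAlone₁ (partner τ₁))
                       (closesVia₁ (g (zero , τ₁ zero))) (zero , zero) (zero , partner τ₁) ⟨
      map (Φ k l ∘ labels P ∘ loc) C₁ ∎
      where
      open ≡-Reasoning
      mV mB : Bool
      mV = mergesV k
      mB = mergesB k
      c₁ : Fin 4 → Bool
      c₁ = closed1 τ₁ mV mB P a
      c₂ : Bool
      c₂ = closed2 τ₁ mV mB P a
      ℓ : Fin 4 → ℕ × ℕ
      ℓ j = Φ k l (labels P (a , j))

    newIso-second : N₂ ≡ map (Φ k l ∘ labels P ∘ loc) C₂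
    newIso-second = begin
      circles (c₁ zero) (c₁ (partner τ₂)) c₂ (ℓ zero) (ℓ (partner τ₂))
        ≡⟨ cong₂ (λ c c′ → circles c c′ c₂ (ℓ zero) (ℓ (partner τ₂))) (closed1-second zero) (closed1-second (partner τ₂)) ⟩
      circles (closesAlone₂ zero) (closesAlone₂ (partner τ₂)) c₂ (ℓ zero) (ℓ (partner τ₂))
        ≡⟨ cong (λ c → circles (closesAlone₂ zero) (closesAlone₂ (partner τ₂)) c (ℓ zero) (ℓ (partner τ₂))) closed2-second ⟩
      circles (closesAlone₂ zero) (closesAlone₂ (partner τ₂)) (closesVia₂ (gap₁ (τ₂ zero))) (ℓ zero) (ℓ (partner τ₂))
        ≡⟨ map-circles (Φ k l ∘ labels P ∘ loc) (closesAlone₂ zero) (closesAlone₂ (partner τ₂))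
                       (closesVia₂ (gap₁ (τ₂ zero))) (suc zero , zero) (suc zero , partner τ₂) ⟨
      map (Φ k l ∘ labels P ∘ loc) C₂ ∎
      where
      open ≡-Reasoning
      c₁ : Fin 4 → Bool
      c₁ = closed1 τ₂ (mergesV l) (mergesB l) P₁ b′
      c₂ : Bool
      c₂ = closed2 τ₂ (mergesV l) (mergesB l) P₁ b′
      ℓ : Fin 4 → ℕ × ℕ
      ℓ j = Φ k l (labels P (b , j))

    iso-twice : iso (apply l P₁ b′) ≡ map (Φ k l) (iso P) ++ map (Φ k l ∘ labels P ∘ loc) newCircles
    iso-twice = begin
      map F₂ (map F₁ (iso P) ++ N₁) ++ N₂
        ≡⟨ cong (_++ N₂) (map-++ F₂ (map F₁ (iso P)) N₁) ⟩
      (map F₂ (map F₁ (iso P)) ++ map F₂ N₁) ++ N₂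
        ≡⟨ ++-assoc (map F₂ (map F₁ (iso P))) (map F₂ N₁) N₂ ⟩
      map F₂ (map F₁ (iso P)) ++ (map F₂ N₁ ++ N₂)
        ≡⟨ cong₂ _++_ (sym (map-∘ (iso P))) (cong₂ _++_ newIso-first newIso-second) ⟩
      map (Φ k l) (iso P) ++ (map h C₁ ++ map h C₂)
        ≡⟨ cong (map (Φ k l) (iso P) ++_) (map-++ h C₁ C₂) ⟨
      map (Φ k l) (iso P) ++ map h newCircles ∎
      where
      open ≡-Reasoning
      h : Local → ℕ × ℕ
      h = Φ k l ∘ labels P ∘ loc

map-++-⊆ : ∀ {A B C : Set} {f f′ : A → B} {h h′ : C → B} (φ : B → B) (xs : List A) {ys zs : List C} →
           (∀ x → f x ≡ φ (f′ x)) → All (λ y → Any (λ z → h y ≡ φ (h′ z)) zs) ys →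
           map f xs ++ map h ys ⊆ map φ (map f′ xs ++ map h′ zs)
map-++-⊆ {f = f} {f′} {h} {h′} φ xs {ys} {zs} f≡φf′ ys⊆zs w∈ with ∈-++⁻ (map f xs) w∈
... | inj₁ w∈fxs with ∈-map⁻ f w∈fxs
...   | x , x∈ , refl = subst (_∈ _) (sym (f≡φf′ x)) (∈-map⁺ φ (∈-++⁺ˡ (∈-map⁺ f′ x∈)))
map-++-⊆ {f = f} {f′} {h} {h′} φ xs {ys} {zs} f≡φf′ ys⊆zs w∈ | inj₂ w∈hys with ∈-map⁻ h w∈hys
...   | y , y∈ , refl with find (All.lookup ys⊆zs y∈)
...     | z , z∈ , hy≡φh′z = subst (_∈ _) (sym hy≡φh′z) (∈-map⁺ φ (∈-++⁺ʳ (map f′ xs) (∈-map⁺ h′ z∈)))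

length-map-++ : ∀ {A B C : Set} {f f′ : A → B} {h h′ : C → B} (xs : List A) {ys zs : List C} →
                length ys ≡ length zs → length (map f xs ++ map h ys) ≡ length (map f′ xs ++ map h′ zs)
length-map-++ {f = f} {f′} {h} {h′} xs {ys} {zs} |ys|≡|zs| = begin
  length (map f xs ++ map h ys)           ≡⟨ length-++ (map f xs) ⟩
  length (map f xs) + length (map h ys)   ≡⟨ cong₂ _+_ (length-map f xs) (length-map h ys) ⟩
  length xs + length ys                   ≡⟨ cong (length xs +_) |ys|≡|zs| ⟩
  length xs + length zs                   ≡⟨ cong₂ _+_ (length-map f′ xs) (length-map h′ zs) ⟨
  length (map f′ xs) + length (map h′ zs) ≡⟨ length-++ (map f′ xs) ⟨
  length (map f′ xs ++ map h′ zs)         ∎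
  where open ≡-Reasoning

module _ {n : ℕ} (P : PAP (suc (suc n))) (wf : WF P) (e : Fin (suc n)) (k l : Op) where
  open WF wf
  private
    module L = TwoEdges P wf zero e
    module R = TwoEdges P wf (suc e) zero

    LHS RHS : PAP n
    LHS = apply l (apply k P zero) e
    RHS = apply k (apply l P (suc e)) zero

    realGap : LocalGap
    realGap p = L.cls (gap P (L.loc p))

    realGap-isLocalGap : IsLocalGap realGap
    realGap-isLocalGap = record
      { irreflexive = λ p eq → gap-fpf (L.loc p) (L.cls-just _ p eq)
      ; symmetric   = λ p q eq → trans (cong L.cls (trans (cong (gap P) (sym (L.cls-just _ q eq))) (gap-invol (L.loc p))))
                                       (L.cls-loc p)
      }

    M : LocalGap
    M = tabulate realGap

    M-spec : ∀ p → M p ≡ L.cls (gap P (L.loc p))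
    M-spec = tabulate-spec realGap

    R-loc : ∀ p → R.loc p ≡ L.loc (swap p)
    R-loc (zero , j)     = refl
    R-loc (suc zero , j) = refl

    R-cls : ∀ y → R.cls y ≡ Data.Maybe.map swap (L.cls y)
    R-cls (zero , j)  = refl
    R-cls (suc i , j) with does (i ≟F e)
    ... | true  = refl
    ... | false = refl

    swapM-spec : ∀ p → swapGap M p ≡ R.cls (gap P (R.loc p))
    swapM-spec p = trans (cong (Data.Maybe.map swap) (M-spec (swap p)))
                         (sym (trans (R-cls (gap P (R.loc p))) (cong (Data.Maybe.map swap ∘ L.cls ∘ gap P) (R-loc p))))

    CL CR : List Local
    CL = LocalModel.newCircles (gluing k) (gluing l) M
    CR = map swap (LocalModel.newCircles (gluing l) (gluing k) (swapGap M))

    ΦL ΦR : ℕ × ℕ → ℕ × ℕ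
    ΦL = L.Φ k l
    ΦR = R.Φ l k

    iso-LHS : iso LHS ≡ map ΦL (iso P) ++ map (ΦL ∘ labels P ∘ L.loc) CL
    iso-LHS = L.iso-twice k l M M-spec

    iso-RHS : iso RHS ≡ map ΦR (iso P) ++ map (ΦR ∘ labels P ∘ L.loc) CR
    iso-RHS = trans (R.iso-twice l k (swapGap M) swapM-spec)
                (cong (map ΦR (iso P) ++_)
                  (trans (map-cong (cong (ΦR ∘ labels P) ∘ R-loc) (LocalModel.newCircles (gluing l) (gluing k) (swapGap M)))
                         (map-∘ (LocalModel.newCircles (gluing l) (gluing k) (swapGap M)))))

    open Matching (local-gaps-match k l realGap-isLocalGap)
    open Connectivity (gluing k) (gluing l) M

    connected-same-label : (Φ : ℕ × ℕ → ℕ × ℕ) →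
                  (∀ j → Φ (labels P (zero , gluing k j)) ≡ Φ (labels P (zero , j))) →
                  (∀ j → Φ (labels P (suc e , gluing l j)) ≡ Φ (labels P (suc e , j))) →
                  ∀ p q → T (connected 8 p q) → Φ (labels P (L.loc p)) ≡ Φ (labels P (L.loc q))
    connected-same-label Φ glue₀ glue₁ = connected-invariant (Φ ∘ labels P ∘ L.loc) along-gap along-glue 8
      where
      along-gap : ∀ p q → M p ≡ just q → Φ (labels P (L.loc q)) ≡ Φ (labels P (L.loc p))
      along-gap p q eq = cong Φ (L.labels-gap (L.cls-just _ q (trans (sym (M-spec p)) eq)))
      along-glue : ∀ p → Φ (labels P (L.loc (glue p))) ≡ Φ (labels P (L.loc p))
      along-glue (zero , j)     = glue₀ j
      along-glue (suc zero , j) = glue₁ j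

    ΦL∘ΦR : ∀ x → ΦL (ΦR x) ≡ ΦL x
    ΦL∘ΦR (v , b) = cong₂ _,_
      (mergeTwice-absorbs (mergesV k) (mergesV l) (vlab P (zero , suc (suc zero))) (vlab P (zero , zero))
                          (vlab P (suc e , suc (suc zero))) (vlab P (suc e , zero)) v)
      (mergeTwice-absorbs (mergesB k) (mergesB l) (blab P (zero , suc zero)) (blab P (zero , zero))
                          (blab P (suc e , suc zero)) (blab P (suc e , zero)) b)

    ΦR∘ΦL : ∀ x → ΦR (ΦL x) ≡ ΦR x
    ΦR∘ΦL (v , b) = cong₂ _,_
      (mergeTwice-absorbs (mergesV l) (mergesV k) (vlab P (suc e , suc (suc zero))) (vlab P (suc e , zero))
                          (vlab P (zero , suc (suc zero))) (vlab P (zero , zero)) v)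
      (mergeTwice-absorbs (mergesB l) (mergesB k) (blab P (suc e , suc zero)) (blab P (suc e , zero))
                          (blab P (zero , suc zero)) (blab P (zero , zero)) b)

    labels-≡ : ∀ x → labels LHS x ≡ ΦL (labels RHS x)
    labels-≡ x = sym (ΦL∘ΦR (labels P (suc (punchIn e (proj₁ x)) , proj₂ x)))

    labels-≡′ : ∀ x → labels RHS x ≡ ΦR (labels LHS x)
    labels-≡′ x = sym (ΦR∘ΦL (labels P (suc (punchIn e (proj₁ x)) , proj₂ x)))

    iso-length : length (iso LHS) ≡ length (iso RHS)
    iso-length = trans (cong length iso-LHS) (trans (length-map-++ (iso P) same-length) (cong length (sym iso-RHS)))

    matched-L : All (λ p → Any (λ q → ΦL (labels P (L.loc p)) ≡ ΦL (ΦR (labels P (L.loc q)))) CR) CL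
    matched-L = All.map (λ {p} → Any.map (λ {q} c →
      trans (connected-same-label ΦL (L.Φ-glue-first k l) (L.Φ-glue-second k l) p q c) (sym (ΦL∘ΦR (labels P (L.loc q))))))
      first⊆second

    matched-R : All (λ q → Any (λ p → ΦR (labels P (L.loc q)) ≡ ΦR (ΦL (labels P (L.loc p)))) CL) CR
    matched-R = All.map (λ {q} → Any.map (λ {p} c →
      trans (connected-same-label ΦR (R.Φ-glue-second l k) (R.Φ-glue-first l k) q p c) (sym (ΦR∘ΦL (labels P (L.loc p))))))
      second⊆first

    LHS⊆RHS : iso LHS ⊆ map ΦL (iso RHS)
    LHS⊆RHS = subst₂ (λ xs ys → xs ⊆ map ΦL ys) (sym iso-LHS) (sym iso-RHS)
                (map-++-⊆ ΦL (iso P) (sym ∘ ΦL∘ΦR) matched-L)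

    RHS⊆LHS : iso RHS ⊆ map ΦR (iso LHS)
    RHS⊆LHS = subst₂ (λ xs ys → xs ⊆ map ΦR ys) (sym iso-RHS) (sym iso-LHS)
                (map-++-⊆ ΦR (iso P) (sym ∘ ΦR∘ΦL) matched-R)

  apply-commute : Coarsening RHS LHS × Coarsening LHS RHS
  apply-commute =
    record { gap-≡ = apply-apply-gap P wf e k l ; φV = L.ΦV k l ; φB = L.ΦB k l
           ; vlab-≡ = cong proj₁ ∘ labels-≡ ; blab-≡ = cong proj₂ ∘ labels-≡
           ; iso-length = iso-length ; iso-⊆ = LHS⊆RHS } ,
    record { gap-≡ = sym ∘ apply-apply-gap P wf e k l ; φV = R.ΦV l k ; φB = R.ΦB l k
           ; vlab-≡ = cong proj₁ ∘ labels-≡′ ; blab-≡ = cong proj₂ ∘ labels-≡′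
           ; iso-length = sym iso-length ; iso-⊆ = RHS⊆LHS }

Q-recursion : Recursion Q
Q-recursion P wf zero = ≈-refl
Q-recursion {suc n} P wf (suc e) = begin
  Q P
    ≈⟨ expand-cong (λ k → Q-recursion (apply k P zero) (apply-wf wf zero k) e) ⟩
  expand (λ k → expand (λ l → Q (apply l (apply k P zero) e)))
    ≈⟨ expand-cong (λ k → expand-cong (λ l →
         Q-cong (proj₂ (apply-commute P wf e k l)) (proj₁ (apply-commute P wf e k l)))) ⟩
  expand (λ k → expand (λ l → Q (apply k (apply l P (suc e)) zero)))
    ≈⟨ expand-swap (λ k l → Q (apply k (apply l P (suc e)) zero)) ⟩
  expand (λ l → Q (apply l P (suc e))) ∎
  where open ≈-Reasoning

Q-base : Base Q
Q-base P wf = ≈-refl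

Q-unique : (Q′ : ∀ {m} → PAP m → Poly) → Recursion Q′ → Base Q′ → ∀ {m} (P : PAP m) → WF P → Q′ P ≈ Q P
Q-unique Q′ rec base {zero}  P wf = base P wf
Q-unique Q′ rec base {suc n} P wf =
  ≈-trans (rec P wf zero) (expand-cong (λ o → Q-unique Q′ rec base (apply o P zero) (apply-wf wf zero o)))

proposition3p2 : Σ (∀ {m} → PAP m → Poly) (λ Q →
    Recursion Q × Base Q ×
    ((Q′ : ∀ {m} → PAP m → Poly) → Recursion Q′ → Base Q′ →
      ∀ {m} (P : PAP m) → WF P → Q′ P ≈ Q P))
proposition3p2 = Q , Q-recursion , Q-base , Q-unique
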